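{- Fix a positive integer $n$ and a prime $p$. Let $\mathcal{K}$ be the set of nonzero sequences $\kappa=(k_1,\dots,k_n)$ of integers with $0\le k_i<p$, and $K=|\mathcal{K}|=p^n-1$. For $r_1,\dots,r_n\in\mathbb{F}^N$ let $X_\kappa(r_1,\dots,r_n)=\sum_{j=1}^N\prod_{i=1}^n r_i(j)^{k_i}$ and $X=(X_\kappa)_{\kappa\in\mathcal{K}}\in\mathbb{F}^K$. Let $r_1,\dots,r_n$ be chosen uniformly and independently from $\mathbb{F}^N$, let $P$ be the distribution of $X$ on $\mathbb{F}^K$ and $U$ the uniform distribution on $\mathbb{F}^K$. Then there is a constant $c>0$ depending on $n,p$ but not on $N$ such that for all sufficiently large $N$, $$\|P-U\|_1\le\exp\{ -cN\}.$$
   Context: $\mathbb{F}=\mathbb{F}_p$; $0^0=1$. $\|P-U\|_1=\sum_{v\in\mathbb{F}^K}|P(v)-U(v)|$ is the statistical ($\ell_1$) distance. -}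

module Defs where

open import Data.Nat as ℕ using (ℕ; zero; suc; _^_; NonZero)
open import Data.Nat.Properties using (m^n≢0)
open import Data.Fin as Fin using (Fin; toℕ; fromℕ<)
open import Data.Fin.Properties using () renaming (_≟_ to _≟F_)
open import Data.List as List using (List; []; _∷_; map; concatMap; filter; length; allFin)
open import Data.List.Properties using (≡-dec)
open import Data.Integer as ℤ using (ℤ; +_)
open import Data.Rational as ℚ using (ℚ; _/_; _-_; _+_; _*_; ∣_∣)
open import Relation.Nullary using (Dec; yes; no; ¬_)
open import Relation.Nullary.Decidable using (⌊_⌋)
open import Relation.Binary.PropositionalEquality using (_≡_)
open import Data.Product using (∃; _,_)
open import Data.Fin.Properties using (any?)

-- Elements of 𝔽 = 𝔽_p are represented by Fin p (residues 0 … p-1).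
-- Reduction of a natural number modulo p into 𝔽_p.
toF : (p : ℕ) → .{{NonZero p}} → ℕ → Fin p
toF p m = Data.Nat.DivMod._mod_ m p
  where import Data.Nat.DivMod

allFuns : ∀ {a} {A : Set a} (m : ℕ) → List A → List (Fin m → A)
allFuns zero    xs = (λ ()) ∷ []
allFuns (suc m) xs =
  concatMap (λ x → map (λ f → λ { Fin.zero → x ; (Fin.suc i) → f i }) (allFuns m xs)) xs

-- All lists of length m over Fin p (= the points of 𝔽^m).
allLists : (p m : ℕ) → List (List (Fin p))
allLists p zero    = [] ∷ []
allLists p (suc m) = concatMap (λ x → map (x ∷_) (allLists p m)) (allFin p)

Nonzero : {n p : ℕ} → (Fin n → Fin p) → Set
Nonzero {n} κ = ∃ λ i → ¬ (toℕ (κ i) ≡ 0)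

nonzero? : {n p : ℕ} → (κ : Fin n → Fin p) → Dec (Nonzero κ)
nonzero? κ = any? (λ i → Relation.Nullary.Decidable.¬? (toℕ (κ i) ℕ.≟ 0))
  where import Relation.Nullary.Decidable

-- The index set 𝒦, enumerated in a fixed order (a list of length p^n - 1).
𝒦 : (n p : ℕ) → List (Fin n → Fin p)
𝒦 n p = filter nonzero? (allFuns n (allFin p))

-- X_κ(r_1,…,r_n) = Σ_{j=1}^N Π_{i=1}^n r_i(j)^{k_i}  in 𝔽_p   (0^0 = 1 in ℕ)
sumℕ : ∀ {m} → (Fin m → ℕ) → ℕ
sumℕ {zero}  f = 0
sumℕ {suc m} f = f Fin.zero ℕ.+ sumℕ (λ i → f (Fin.suc i))

prodℕ : ∀ {m} → (Fin m → ℕ) → ℕ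
prodℕ {zero}  f = 1
prodℕ {suc m} f = f Fin.zero ℕ.* prodℕ (λ i → f (Fin.suc i))

Xκ : (n p N : ℕ) → .{{NonZero p}} → (Fin n → Fin p) → (Fin n → Fin N → Fin p) → Fin p
Xκ n p N κ r = toF p (sumℕ {N} λ j → prodℕ {n} λ i → toℕ (r i j) ^ toℕ (κ i))

-- X = (X_κ)_{κ ∈ 𝒦} ∈ 𝔽^K, as a list indexed along the enumeration 𝒦 n p
X : (n p N : ℕ) → .{{NonZero p}} → (Fin n → Fin N → Fin p) → List (Fin p)
X n p N r = map (λ κ → Xκ n p N κ r) (𝒦 n p)

K : (n p : ℕ) → ℕ
K n p = length (𝒦 n p)

-- All (r_1,…,r_n) ∈ (𝔽^N)^n, each equally likely (uniform, independent)
samples : (n p N : ℕ) → List (Fin n → Fin N → Fin p)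
samples n p N = allFuns n (allFuns N (allFin p))

P : (n p N : ℕ) → .{{NonZero p}} → List (Fin p) → ℚ
P n p N v = _/_ (+ length (filter (λ r → ≡-dec _≟F_ (X n p N r) v) (samples n p N)))
              (p ^ (n ℕ.* N)) {{m^n≢0 p (n ℕ.* N)}}

U : (n p : ℕ) → .{{NonZero p}} → List (Fin p) → ℚ
U n p v = _/_ (+ 1) (p ^ K n p) {{m^n≢0 p (K n p)}}

sumℚ : List ℚ → ℚ
sumℚ = List.foldr _+_ ℚ.0ℚ

dist : (n p N : ℕ) → .{{NonZero p}} → ℚ
dist n p N = sumℚ (map (λ v → ∣ P n p N v - U n p v ∣) (allLists p (K n p)))

powℚ : ℚ → ℕ → ℚ
powℚ q zero    = ℚ.1ℚ
powℚ q (suc m) = q * powℚ q m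

module Submission where

-- Everything is a count.  Splitting off one column of (r_1,…,r_n) shows
-- X_{N+1} = X_N + φ(c), where c ∈ 𝔽^n is that column and φ(c) = (c^κ)_κ is the
-- vector of monomials at c: X is a random walk on the group 𝔽^K whose steps are
-- φ(c) for a uniform point c.  The proof is Doeblin's coupling argument.
--  * Spanning: every v ∈ 𝔽^K is a sum of steps φ(c) (unit vectors are
--    ℕ-combinations of the φ(c), by interpolation with power sums over 𝔽_p and
--    Fermat's little theorem); since φ(0) = 0, all v are reached in one common
--    number M of steps.
--  * Contraction: if each v is reached by at least one of the L = p^{nM} step
--    sequences of length M, and E = L - p^K, then the defect
--    #samples - p^K · #{X_N = v} is multiplied by at most E every M steps.
--  * Hence ‖P - U‖₁ ≤ 2 (E/L)^⌊N/M⌋, and two Bernoulli inequalities turn this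
--    into the bound q^N for the explicit rational q = a/(a + p^K) < 1.
-- The file develops: finite sums and enumerations; arithmetic in 𝔽_p and 𝔽^K;
-- binomials, Fermat and power sums; the walk decomposition; the Doeblin step;
-- spanning; the passage to ℚ; the rate arithmetic; and finally the theorem.

open import Data.Nat as ℕ
  using (ℕ; zero; suc; _+_; _*_; _^_; _∸_; _≤_; _<_; z≤n; s≤s; NonZero; _%_; _/_; _≟_)
open import Data.Nat.Properties
open import Data.Nat.DivMod
open import Data.Nat.Divisibility
open import Data.Nat.Primality using (Prime; euclidsLemma; prime⇒nonZero; ¬prime[0]; ¬prime[1])
open import Data.Nat.Tactic.RingSolver using (solve-∀)
open import Data.Fin as Fin using (Fin; toℕ)
open import Data.Fin.Properties using (toℕ-fromℕ<; toℕ-injective; toℕ<n) renaming (_≟_ to _≟F_; suc-injective to Fin-suc-injective)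
open import Data.List as List using (List; []; _∷_; map; concatMap; filter; length; _++_; allFin)
open import Data.List.Properties using (≡-dec; ∷-injective; map-cong; map-cong-local; map-tabulate; length-map; length-tabulate; zipWith-comm)
open import Data.List.Membership.Propositional using (_∈_)
open import Data.List.Membership.Propositional.Properties using (∈-map⁺; ∈-++⁺ˡ; ∈-++⁺ʳ; ∈-allFin)
open import Data.List.Relation.Unary.Any using (here; there)
open import Data.List.Relation.Unary.All as All using (All; []; _∷_)
import Data.List.Relation.Unary.All.Properties as AllP
open import Data.List.Relation.Unary.AllPairs as AllPairs using (AllPairs; []; _∷_)
import Data.List.Relation.Unary.AllPairs.Properties as AllPairsP
open import Data.List.Relation.Unary.Unique.Propositional.Properties using (allFin⁺)
open import Data.Product using (Σ; _×_; _,_; proj₁; proj₂)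
open import Data.Sum using (inj₁; inj₂)
open import Data.Empty using (⊥-elim)
open import Function using (_∘_)
open import Relation.Nullary using (Dec; yes; no; ¬_; _×-dec_)
open import Relation.Binary.PropositionalEquality
open import Relation.Binary.Definitions using (Tri; tri<; tri≈; tri>)
open import Algebra.Properties.CommutativeSemigroup +-commutativeSemigroup
  using () renaming (interchange to +-interchange; x∙yz≈y∙xz to +-x∙yz≈y∙xz)
open import Algebra.Properties.CommutativeSemigroup *-commutativeSemigroup
  using () renaming (x∙yz≈y∙xz to *-x∙yz≈y∙xz)
open import Data.Nat.Induction using (<-rec)
open import Defs

∑ : {A : Set} → List A → (A → ℕ) → ℕ
∑ []       f = 0
∑ (x ∷ xs) f = f x + ∑ xs f

𝟙 : {P : Set} → Dec P → ℕ
𝟙 (yes _) = 1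
𝟙 (no _)  = 0

𝟙-yes : {P : Set} (d : Dec P) → P → 𝟙 d ≡ 1
𝟙-yes (yes _) _  = refl
𝟙-yes (no ¬x) x = ⊥-elim (¬x x)

𝟙-no : {P : Set} (d : Dec P) → ¬ P → 𝟙 d ≡ 0
𝟙-no (yes x) ¬x = ⊥-elim (¬x x)
𝟙-no (no _)  _  = refl

𝟙-cong : {P Q : Set} (d : Dec P) (e : Dec Q) → (P → Q) → (Q → P) → 𝟙 d ≡ 𝟙 e
𝟙-cong (yes _) (yes _) f g = refl
𝟙-cong (yes x) (no y)  f g = ⊥-elim (y (f x))
𝟙-cong (no x)  (yes y) f g = ⊥-elim (x (g y))
𝟙-cong (no _)  (no _)  f g = refl

𝟙-mono : {P Q : Set} (d : Dec P) (e : Dec Q) → (P → Q) → 𝟙 d ≤ 𝟙 e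
𝟙-mono (yes x) (yes _) f = ≤-refl
𝟙-mono (yes x) (no y)  f = ⊥-elim (y (f x))
𝟙-mono (no _)  e       f = z≤n

𝟙-× : {P Q : Set} (d : Dec P) (e : Dec Q) → 𝟙 (d ×-dec e) ≡ 𝟙 d * 𝟙 e
𝟙-× (yes _) (yes _) = refl
𝟙-× (yes _) (no _)  = refl
𝟙-× (no _)  _       = refl

module _ {A : Set} where

  ∑-cong : (xs : List A) {f g : A → ℕ} → (∀ x → f x ≡ g x) → ∑ xs f ≡ ∑ xs g
  ∑-cong []       e = refl
  ∑-cong (x ∷ xs) e = cong₂ _+_ (e x) (∑-cong xs e)

  ∑-congAll : {P : A → Set} (xs : List A) {f g : A → ℕ} →
              All P xs → (∀ x → P x → f x ≡ g x) → ∑ xs f ≡ ∑ xs g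
  ∑-congAll []       []         e = refl
  ∑-congAll (x ∷ xs) (px ∷ pxs) e = cong₂ _+_ (e x px) (∑-congAll xs pxs e)

  ∑-monoAll : {P : A → Set} (xs : List A) {f g : A → ℕ} →
              All P xs → (∀ x → P x → f x ≤ g x) → ∑ xs f ≤ ∑ xs g
  ∑-monoAll []       []         e = z≤n
  ∑-monoAll (x ∷ xs) (px ∷ pxs) e = +-mono-≤ (e x px) (∑-monoAll xs pxs e)

  ∑-mono : (xs : List A) {f g : A → ℕ} → (∀ x → f x ≤ g x) → ∑ xs f ≤ ∑ xs g
  ∑-mono []       e = z≤n
  ∑-mono (x ∷ xs) e = +-mono-≤ (e x) (∑-mono xs e)

  ∑-++ : (xs ys : List A) (f : A → ℕ) → ∑ (xs ++ ys) f ≡ ∑ xs f + ∑ ys f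
  ∑-++ []       ys f = refl
  ∑-++ (x ∷ xs) ys f = trans (cong (f x +_) (∑-++ xs ys f)) (sym (+-assoc (f x) (∑ xs f) (∑ ys f)))

  ∑-+ : (xs : List A) (f g : A → ℕ) → ∑ xs (λ x → f x + g x) ≡ ∑ xs f + ∑ xs g
  ∑-+ []       f g = refl
  ∑-+ (x ∷ xs) f g =
    trans (cong (f x + g x +_) (∑-+ xs f g)) (+-interchange (f x) (g x) (∑ xs f) (∑ xs g))

  ∑-*ˡ : (xs : List A) (c : ℕ) (f : A → ℕ) → ∑ xs (λ x → c * f x) ≡ c * ∑ xs f
  ∑-*ˡ []       c f = sym (*-zeroʳ c)
  ∑-*ˡ (x ∷ xs) c f = trans (cong (c * f x +_) (∑-*ˡ xs c f)) (sym (*-distribˡ-+ c (f x) _))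

  ∑-*ʳ : (xs : List A) (c : ℕ) (f : A → ℕ) → ∑ xs (λ x → f x * c) ≡ ∑ xs f * c
  ∑-*ʳ xs c f = trans (∑-cong xs (λ x → *-comm (f x) c)) (trans (∑-*ˡ xs c f) (*-comm c _))

  ∑-const : (xs : List A) (c : ℕ) → ∑ xs (λ _ → c) ≡ length xs * c
  ∑-const []       c = refl
  ∑-const (x ∷ xs) c = cong (c +_) (∑-const xs c)

  length≡∑1 : (xs : List A) → length xs ≡ ∑ xs (λ _ → 1)
  length≡∑1 xs = sym (trans (∑-const xs 1) (*-identityʳ (length xs)))

  ∑-zero : (xs : List A) {f : A → ℕ} → (∀ x → f x ≡ 0) → ∑ xs f ≡ 0
  ∑-zero xs e = trans (∑-cong xs e) (trans (∑-const xs 0) (*-zeroʳ (length xs)))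

  term≤∑ : (xs : List A) (f : A → ℕ) {x : A} → x ∈ xs → f x ≤ ∑ xs f
  term≤∑ (y ∷ xs) f (here refl) = m≤m+n (f y) _
  term≤∑ (y ∷ xs) f (there x∈) = ≤-trans (term≤∑ xs f x∈) (m≤n+m _ (f y))

  length-filter : {P : A → Set} (P? : ∀ x → Dec (P x)) (xs : List A) →
                  length (filter P? xs) ≡ ∑ xs (λ x → 𝟙 (P? x))
  length-filter P? []       = refl
  length-filter P? (x ∷ xs) with P? x
  ... | yes _ = cong suc (length-filter P? xs)
  ... | no _  = length-filter P? xs

module _ {A B : Set} where

  ∑-map : (g : A → B) (xs : List A) (f : B → ℕ) → ∑ (map g xs) f ≡ ∑ xs (f ∘ g)
  ∑-map g []       f = refl
  ∑-map g (x ∷ xs) f = cong (f (g x) +_) (∑-map g xs f)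

  ∑-concatMap : (g : A → List B) (xs : List A) (f : B → ℕ) →
                ∑ (concatMap g xs) f ≡ ∑ xs (λ x → ∑ (g x) f)
  ∑-concatMap g []       f = refl
  ∑-concatMap g (x ∷ xs) f = trans (∑-++ (g x) _ f) (cong (∑ (g x) f +_) (∑-concatMap g xs f))

  ∑-swap : (xs : List A) (ys : List B) (h : A → B → ℕ) →
           ∑ xs (λ x → ∑ ys (h x)) ≡ ∑ ys (λ y → ∑ xs (λ x → h x y))
  ∑-swap []       ys h = sym (∑-zero ys (λ _ → refl))
  ∑-swap (x ∷ xs) ys h =
    trans (cong (∑ ys (h x) +_) (∑-swap xs ys h)) (sym (∑-+ ys (h x) (λ y → ∑ xs (λ x' → h x' y))))

-- Powers distribute over products (the library states this only for the generic
-- semiring power, which is not definitionally ℕ's _^_).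
^-distribʳ-* : ∀ a b k → (a * b) ^ k ≡ a ^ k * b ^ k
^-distribʳ-* a b zero    = refl
^-distribʳ-* a b (suc k) = trans (cong (a * b *_) (^-distribʳ-* a b k)) ([m*n]*[o*p]≡[m*o]*[n*p] a b (a ^ k) (b ^ k))

^-comm : ∀ a m k → (a ^ m) ^ k ≡ (a ^ k) ^ m
^-comm a m k = trans (^-*-assoc a m k) (trans (cong (a ^_) (*-comm m k)) (sym (^-*-assoc a k m)))

-- Since
-- functions are compared pointwise, summands must respect a pointwise relation.
Extensional : {A : Set} (_~_ : A → A → Set) {m : ℕ} → ((Fin m → A) → ℕ) → Set
Extensional _~_ h = ∀ f g → (∀ i → f i ~ g i) → h f ≡ h g

_◂_ : {A : Set} {m : ℕ} → A → (Fin m → A) → Fin (suc m) → A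
(x ◂ f) Fin.zero    = x
(x ◂ f) (Fin.suc i) = f i

∑-allFuns-suc : {A : Set} (_~_ : A → A → Set) → (∀ a → a ~ a) →
                (m : ℕ) (xs : List A) (h : (Fin (suc m) → A) → ℕ) → Extensional _~_ h →
                ∑ (allFuns (suc m) xs) h ≡ ∑ xs (λ x → ∑ (allFuns m xs) (λ f → h (x ◂ f)))
∑-allFuns-suc _~_ ~-refl m xs h ext =
  trans (∑-concatMap _ xs h)
    (∑-cong xs (λ x → trans (∑-map _ (allFuns m xs) h)
      (∑-cong (allFuns m xs) (λ f → ext _ _ λ { Fin.zero → ~-refl x ; (Fin.suc i) → ~-refl (f i) }))))

length-allFuns : {A : Set} (m : ℕ) (xs : List A) → length (allFuns m xs) ≡ length xs ^ m
length-allFuns zero    xs = refl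
length-allFuns (suc m) xs = begin
  length (allFuns (suc m) xs)                  ≡⟨ length≡∑1 (allFuns (suc m) xs) ⟩
  ∑ (allFuns (suc m) xs) (λ _ → 1)             ≡⟨ ∑-allFuns-suc _≡_ (λ _ → refl) m xs (λ _ → 1) (λ _ _ _ → refl) ⟩
  ∑ xs (λ _ → ∑ (allFuns m xs) (λ _ → 1))      ≡⟨ ∑-const xs _ ⟩
  length xs * ∑ (allFuns m xs) (λ _ → 1)       ≡⟨ cong (length xs *_) (sym (length≡∑1 (allFuns m xs))) ⟩
  length xs * length (allFuns m xs)            ≡⟨ cong (length xs *_) (length-allFuns m xs) ⟩
  length xs * length xs ^ m                    ∎
  where open ≡-Reasoning

∑-allFuns-grid : {A B C : Set} (n : ℕ) (as : List A) (bs : List B) (g : A → B → C)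
                 (h : (Fin n → C) → ℕ) → Extensional _≡_ h →
                 ∑ (allFuns n (concatMap (λ a → map (g a) bs) as)) h
                   ≡ ∑ (allFuns n as) (λ c → ∑ (allFuns n bs) (λ r → h (λ i → g (c i) (r i))))
∑-allFuns-grid zero    as bs g h ext = cong (_+ 0) (trans (ext _ _ (λ ())) (sym (+-identityʳ _)))
∑-allFuns-grid {A} {B} {C} (suc n) as bs g h ext = begin
  ∑ (allFuns (suc n) grid) h
    ≡⟨ ∑-allFuns-suc _≡_ (λ _ → refl) n grid h ext ⟩
  ∑ grid (λ z → ∑ (allFuns n grid) (λ f → h (z ◂ f)))
    ≡⟨ trans (∑-concatMap _ as _) (∑-cong as (λ a → ∑-map (g a) bs _)) ⟩
  ∑ as (λ a → ∑ bs (λ b → ∑ (allFuns n grid) (λ f → h (g a b ◂ f))))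
    ≡⟨ ∑-cong as (λ a → ∑-cong bs (λ b → ∑-allFuns-grid n as bs g _ (λ f f' e → ext _ _ (◂-cong refl e)))) ⟩
  ∑ as (λ a → ∑ bs (λ b → ∑ (allFuns n as) (λ c → ∑ (allFuns n bs) (λ r → h (g a b ◂ pair c r)))))
    ≡⟨ ∑-cong as (λ a → ∑-swap bs (allFuns n as) _) ⟩
  ∑ as (λ a → ∑ (allFuns n as) (λ c → ∑ bs (λ b → ∑ (allFuns n bs) (λ r → h (g a b ◂ pair c r)))))
    ≡⟨ ∑-cong as (λ a → ∑-cong (allFuns n as) (λ c → sym (∑-allFuns-suc _≡_ (λ _ → refl) n bs _
         (λ r r' e → ext _ _ (◂-cong (cong (g a) (e Fin.zero)) (λ i → cong (g (c i)) (e (Fin.suc i)))))))) ⟩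
  ∑ as (λ a → ∑ (allFuns n as) (λ c → ∑ (allFuns (suc n) bs) (λ r → h (g a (r Fin.zero) ◂ pair c (r ∘ Fin.suc)))))
    ≡⟨ sym (∑-allFuns-suc _≡_ (λ _ → refl) n as _ (λ c c' e → ∑-cong (allFuns (suc n) bs) (λ r → ext _ _
         (◂-cong (cong (λ x → g x (r Fin.zero)) (e Fin.zero)) (λ i → cong (λ x → g x (r (Fin.suc i))) (e (Fin.suc i))))))) ⟩
  ∑ (allFuns (suc n) as) (λ c → ∑ (allFuns (suc n) bs) (λ r → h (g (c Fin.zero) (r Fin.zero) ◂ pair (c ∘ Fin.suc) (r ∘ Fin.suc))))
    ≡⟨ ∑-cong (allFuns (suc n) as) (λ c → ∑-cong (allFuns (suc n) bs) (λ r → ext _ _ λ { Fin.zero → refl ; (Fin.suc i) → refl })) ⟩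
  ∑ (allFuns (suc n) as) (λ c → ∑ (allFuns (suc n) bs) (λ r → h (pair c r))) ∎
  where
  open ≡-Reasoning
  grid = concatMap (λ a → map (g a) bs) as
  pair : ∀ {k} → (Fin k → A) → (Fin k → B) → Fin k → C
  pair c r i = g (c i) (r i)
  ◂-cong : ∀ {z z'} {f f' : Fin n → C} → z ≡ z' → (∀ i → f i ≡ f' i) → ∀ i → (z ◂ f) i ≡ (z' ◂ f') i
  ◂-cong z≡z' e Fin.zero    = z≡z'
  ◂-cong z≡z' e (Fin.suc i) = e i

∈-grid : {A B C : Set} (g : A → B → C) {as : List A} {bs : List B} {a : A} {b : B} →
         a ∈ as → b ∈ bs → g a b ∈ concatMap (λ x → map (g x) bs) as
∈-grid g {a ∷ as}  (here refl) b∈ = ∈-++⁺ˡ (∈-map⁺ (g a) b∈)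
∈-grid g {a ∷ as} {bs} (there a∈) b∈ = ∈-++⁺ʳ (map (g a) bs) (∈-grid g a∈ b∈)

allFuns-complete : {A : Set} (m : ℕ) (xs : List A) (g : Fin m → A) → (∀ i → g i ∈ xs) →
                   Σ (Fin m → A) λ c → c ∈ allFuns m xs × (∀ i → c i ≡ g i)
allFuns-complete zero    xs g g∈ = _ , here refl , λ ()
allFuns-complete (suc m) xs g g∈ with allFuns-complete m xs (g ∘ Fin.suc) (g∈ ∘ Fin.suc)
... | c , c∈ , c≗ = _ , ∈-grid _ (g∈ Fin.zero) c∈ , λ { Fin.zero → refl ; (Fin.suc i) → c≗ i }

Distinct : {A : Set} {m : ℕ} → (Fin m → A) → (Fin m → A) → Set
Distinct f g = ¬ (∀ i → f i ≡ g i)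

grid-distinct : {A : Set} {m : ℕ} (F : A → (Fin m → A) → Fin (suc m) → A) →
                (∀ x f → F x f Fin.zero ≡ x) → (∀ x f i → F x f (Fin.suc i) ≡ f i) →
                {xs : List A} {fs : List (Fin m → A)} →
                AllPairs (λ x y → ¬ x ≡ y) xs → AllPairs Distinct fs →
                AllPairs Distinct (concatMap (λ x → map (F x) fs) xs)
grid-distinct F head tail {xs} {fs} dxs dfs =
  AllPairsP.concat⁺ (AllP.map⁺ (All.universal rows xs)) (AllPairsP.map⁺ (AllPairs.map across dxs))
  where
  rows : ∀ x → AllPairs Distinct (map (F x) fs)
  rows x = AllPairsP.map⁺ (AllPairs.map (λ {f} {g} f≠g e →
             f≠g (λ i → trans (sym (tail x f i)) (trans (e (Fin.suc i)) (tail x g i)))) dfs)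
  across : ∀ {x y} → ¬ x ≡ y → All (λ u → All (Distinct u) (map (F y) fs)) (map (F x) fs)
  across {x} {y} x≠y = AllP.map⁺ (All.universal (λ f → AllP.map⁺ (All.universal (λ g e →
    x≠y (trans (sym (head x f)) (trans (e Fin.zero) (head y g)))) fs)) fs)

allFuns-distinct : {A : Set} (m : ℕ) (xs : List A) →
                   AllPairs (λ x y → ¬ x ≡ y) xs → AllPairs Distinct (allFuns m xs)
allFuns-distinct zero    xs _   = [] ∷ []
allFuns-distinct (suc m) xs dxs =
  grid-distinct _ (λ _ _ → refl) (λ _ _ _ → refl) dxs (allFuns-distinct m xs dxs)

∑-allFin-suc : (n : ℕ) (f : Fin (suc n) → ℕ) → ∑ (allFin (suc n)) f ≡ f Fin.zero + ∑ (allFin n) (f ∘ Fin.suc)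
∑-allFin-suc n f = cong (f Fin.zero +_) (trans (cong (λ l → ∑ l f) (sym (map-tabulate (λ i → i) Fin.suc)))
                                              (∑-map Fin.suc (allFin n) f))

count-allFin : (n : ℕ) (a : Fin n) → ∑ (allFin n) (λ x → 𝟙 (x ≟F a)) ≡ 1
count-allFin (suc n) Fin.zero = trans (∑-allFin-suc n (λ x → 𝟙 (x ≟F Fin.zero))) (cong suc (∑-zero (allFin n) (λ _ → refl)))
count-allFin (suc n) (Fin.suc a) = trans (∑-allFin-suc n (λ x → 𝟙 (x ≟F Fin.suc a))) (trans
  (∑-cong (allFin n) (λ x → 𝟙-cong (Fin.suc x ≟F Fin.suc a) (x ≟F a) Fin-suc-injective (cong Fin.suc)))
  (count-allFin n a))

_≟L_ : {p : ℕ} (u v : List (Fin p)) → Dec (u ≡ v)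
_≟L_ = ≡-dec _≟F_

allLists-length : (p m : ℕ) → All (λ w → length w ≡ m) (allLists p m)
allLists-length p zero    = refl ∷ []
allLists-length p (suc m) = rows (allFin p)
  where
  rows : ∀ xs → All (λ w → length w ≡ suc m) (concatMap (λ x → map (x ∷_) (allLists p m)) xs)
  rows []       = []
  rows (x ∷ xs) = AllP.++⁺ (AllP.map⁺ (All.map (cong suc) (allLists-length p m))) (rows xs)

length-allLists : (p m : ℕ) → length (allLists p m) ≡ p ^ m
length-allLists p zero    = refl
length-allLists p (suc m) = begin
  length (allLists p (suc m))                               ≡⟨ length≡∑1 (allLists p (suc m)) ⟩
  ∑ (allLists p (suc m)) (λ _ → 1)                          ≡⟨ ∑-concatMap _ (allFin p) _ ⟩
  ∑ (allFin p) (λ x → ∑ (map (x ∷_) (allLists p m)) (λ _ → 1)) ≡⟨ ∑-cong (allFin p) (λ x → ∑-map _ (allLists p m) _) ⟩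
  ∑ (allFin p) (λ _ → ∑ (allLists p m) (λ _ → 1))           ≡⟨ ∑-const (allFin p) _ ⟩
  length (allFin p) * ∑ (allLists p m) (λ _ → 1)            ≡⟨ cong₂ _*_ (length-tabulate {n = p} (λ i → i)) (sym (length≡∑1 (allLists p m))) ⟩
  p * length (allLists p m)                                 ≡⟨ cong (p *_) (length-allLists p m) ⟩
  p * p ^ m                                                 ∎
  where open ≡-Reasoning

count-allLists : (p m : ℕ) (u : List (Fin p)) → length u ≡ m → ∑ (allLists p m) (λ w → 𝟙 (w ≟L u)) ≡ 1
count-allLists p zero    [] refl = refl
count-allLists p (suc m) (a ∷ u) len = begin
  ∑ (allLists p (suc m)) (λ w → 𝟙 (w ≟L (a ∷ u)))
    ≡⟨ ∑-concatMap _ (allFin p) _ ⟩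
  ∑ (allFin p) (λ x → ∑ (map (x ∷_) (allLists p m)) (λ w → 𝟙 (w ≟L (a ∷ u))))
    ≡⟨ ∑-cong (allFin p) (λ x → trans (∑-map (x ∷_) (allLists p m) _) (∑-cong (allLists p m) (λ w → 𝟙-∷ x w))) ⟩
  ∑ (allFin p) (λ x → ∑ (allLists p m) (λ w → 𝟙 (x ≟F a) * 𝟙 (w ≟L u)))
    ≡⟨ ∑-cong (allFin p) (λ x → ∑-*ˡ (allLists p m) (𝟙 (x ≟F a)) _) ⟩
  ∑ (allFin p) (λ x → 𝟙 (x ≟F a) * ∑ (allLists p m) (λ w → 𝟙 (w ≟L u)))
    ≡⟨ ∑-cong (allFin p) (λ x → cong (𝟙 (x ≟F a) *_) (count-allLists p m u (suc-injective len))) ⟩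
  ∑ (allFin p) (λ x → 𝟙 (x ≟F a) * 1)
    ≡⟨ ∑-cong (allFin p) (λ x → *-identityʳ _) ⟩
  ∑ (allFin p) (λ x → 𝟙 (x ≟F a))
    ≡⟨ count-allFin p a ⟩
  1 ∎
  where
  open ≡-Reasoning
  𝟙-∷ : ∀ x w → 𝟙 ((x ∷ w) ≟L (a ∷ u)) ≡ 𝟙 (x ≟F a) * 𝟙 (w ≟L u)
  𝟙-∷ x w = trans (𝟙-cong ((x ∷ w) ≟L (a ∷ u)) ((x ≟F a) ×-dec (w ≟L u))
                          ∷-injective (λ { (e₁ , e₂) → cong₂ _∷_ e₁ e₂ }))
                  (𝟙-× (x ≟F a) (w ≟L u))

∑-pick : (p m : ℕ) (u₀ : List (Fin p)) (f : List (Fin p) → ℕ) → length u₀ ≡ m →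
         ∑ (allLists p m) (λ u → 𝟙 (u₀ ≟L u) * f u) ≡ f u₀
∑-pick p m u₀ f len = begin
  ∑ (allLists p m) (λ u → 𝟙 (u₀ ≟L u) * f u)  ≡⟨ ∑-cong (allLists p m) only-u₀ ⟩
  ∑ (allLists p m) (λ u → 𝟙 (u ≟L u₀) * f u₀) ≡⟨ ∑-*ʳ (allLists p m) (f u₀) _ ⟩
  ∑ (allLists p m) (λ u → 𝟙 (u ≟L u₀)) * f u₀ ≡⟨ cong (_* f u₀) (count-allLists p m u₀ len) ⟩
  1 * f u₀                                     ≡⟨ *-identityˡ _ ⟩
  f u₀                                         ∎
  where
  open ≡-Reasoning
  only-u₀ : ∀ u → 𝟙 (u₀ ≟L u) * f u ≡ 𝟙 (u ≟L u₀) * f u₀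
  only-u₀ u with u₀ ≟L u | u ≟L u₀
  ... | yes refl | yes _  = refl
  ... | yes refl | no ne  = ⊥-elim (ne refl)
  ... | no ne    | yes refl = ⊥-elim (ne refl)
  ... | no _     | no _   = refl

∑-fibres : {B : Set} (p m : ℕ) (xs : List B) (Y : B → List (Fin p)) (f : List (Fin p) → ℕ) →
           (∀ x → length (Y x) ≡ m) →
           ∑ xs (λ x → f (Y x)) ≡ ∑ (allLists p m) (λ u → ∑ xs (λ x → 𝟙 (Y x ≟L u)) * f u)
∑-fibres p m xs Y f len = begin
  ∑ xs (λ x → f (Y x))                                      ≡⟨ ∑-cong xs (λ x → sym (∑-pick p m (Y x) f (len x))) ⟩
  ∑ xs (λ x → ∑ W (λ u → 𝟙 (Y x ≟L u) * f u))               ≡⟨ ∑-swap xs W _ ⟩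
  ∑ W (λ u → ∑ xs (λ x → 𝟙 (Y x ≟L u) * f u))               ≡⟨ ∑-cong W (λ u → ∑-*ʳ xs (f u) _) ⟩
  ∑ W (λ u → ∑ xs (λ x → 𝟙 (Y x ≟L u)) * f u)               ∎
  where
  open ≡-Reasoning
  W = allLists p m

sumℕ-cong : {m : ℕ} {f g : Fin m → ℕ} → (∀ i → f i ≡ g i) → sumℕ f ≡ sumℕ g
sumℕ-cong {zero}  e = refl
sumℕ-cong {suc m} e = cong₂ _+_ (e Fin.zero) (sumℕ-cong (e ∘ Fin.suc))

prodℕ-cong : {m : ℕ} {f g : Fin m → ℕ} → (∀ i → f i ≡ g i) → prodℕ f ≡ prodℕ g
prodℕ-cong {zero}  e = refl
prodℕ-cong {suc m} e = cong₂ _*_ (e Fin.zero) (prodℕ-cong (e ∘ Fin.suc))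

prodℕ-* : {m : ℕ} (f g : Fin m → ℕ) → prodℕ f * prodℕ g ≡ prodℕ (λ i → f i * g i)
prodℕ-* {zero}  f g = refl
prodℕ-* {suc m} f g =
  trans ([m*n]*[o*p]≡[m*o]*[n*p] (f Fin.zero) (prodℕ (f ∘ Fin.suc)) (g Fin.zero) (prodℕ (g ∘ Fin.suc)))
        (cong (f Fin.zero * g Fin.zero *_) (prodℕ-* (f ∘ Fin.suc) (g ∘ Fin.suc)))

prodℕ-zero : {m : ℕ} (f : Fin m → ℕ) (i : Fin m) → f i ≡ 0 → prodℕ f ≡ 0
prodℕ-zero {suc m} f Fin.zero    e = cong (_* prodℕ (f ∘ Fin.suc)) e
prodℕ-zero {suc m} f (Fin.suc i) e = trans (cong (f Fin.zero *_) (prodℕ-zero (f ∘ Fin.suc) i e)) (*-zeroʳ (f Fin.zero))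

∑-allFuns-prodℕ : {A : Set} (m : ℕ) (xs : List A) (h : Fin m → A → ℕ) →
                  ∑ (allFuns m xs) (λ x → prodℕ (λ i → h i (x i))) ≡ prodℕ (λ i → ∑ xs (h i))
∑-allFuns-prodℕ zero    xs h = refl
∑-allFuns-prodℕ (suc m) xs h = begin
  ∑ (allFuns (suc m) xs) (λ x → prodℕ (λ i → h i (x i)))
    ≡⟨ ∑-allFuns-suc _≡_ (λ _ → refl) m xs _ (λ g g' e → prodℕ-cong (λ i → cong (h i) (e i))) ⟩
  ∑ xs (λ a → ∑ (allFuns m xs) (λ f → h₀ a * prodℕ (λ i → h (Fin.suc i) (f i))))
    ≡⟨ ∑-cong xs (λ a → ∑-*ˡ (allFuns m xs) (h₀ a) _) ⟩
  ∑ xs (λ a → h₀ a * ∑ (allFuns m xs) (λ f → prodℕ (λ i → h (Fin.suc i) (f i))))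
    ≡⟨ ∑-cong xs (λ a → cong (h₀ a *_) (∑-allFuns-prodℕ m xs (h ∘ Fin.suc))) ⟩
  ∑ xs (λ a → h₀ a * prodℕ (λ i → ∑ xs (h (Fin.suc i))))
    ≡⟨ ∑-*ʳ xs _ h₀ ⟩
  ∑ xs h₀ * prodℕ (λ i → ∑ xs (h (Fin.suc i))) ∎
  where
  open ≡-Reasoning
  h₀ = h Fin.zero

module Residues {p : ℕ} .{{_ : NonZero p}} where

  infix 4 _≡ₚ_
  _≡ₚ_ : ℕ → ℕ → Set
  m ≡ₚ n = m % p ≡ n % p

  ≡ₚ-+ˡ : ∀ x y z → x ≡ₚ y → x + z ≡ₚ y + z
  ≡ₚ-+ˡ x y z e = trans (%-distribˡ-+ x z p) (trans (cong (λ t → (t + z % p) % p) e) (sym (%-distribˡ-+ y z p)))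

  ≡ₚ-+ʳ : ∀ x y z → x ≡ₚ y → z + x ≡ₚ z + y
  ≡ₚ-+ʳ x y z e = trans (cong (_% p) (+-comm z x)) (trans (≡ₚ-+ˡ x y z e) (cong (_% p) (+-comm y z)))

  ≡ₚ-*ˡ : ∀ x y z → x ≡ₚ y → x * z ≡ₚ y * z
  ≡ₚ-*ˡ x y z e = trans (%-distribˡ-* x z p) (trans (cong (λ t → (t * (z % p)) % p) e) (sym (%-distribˡ-* y z p)))

  ≡ₚ-*ʳ : ∀ x y z → x ≡ₚ y → z * x ≡ₚ z * y
  ≡ₚ-*ʳ x y z e = trans (cong (_% p) (*-comm z x)) (trans (≡ₚ-*ˡ x y z e) (cong (_% p) (*-comm y z)))

  ≡ₚ-% : ∀ x → x % p ≡ₚ x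
  ≡ₚ-% x = m%n%n≡m%n x p

  ≡ₚ-prodℕ : {m : ℕ} (a b : Fin m → ℕ) → (∀ i → a i ≡ₚ b i) → prodℕ a ≡ₚ prodℕ b
  ≡ₚ-prodℕ {zero}  a b e = refl
  ≡ₚ-prodℕ {suc m} a b e =
    trans (≡ₚ-*ˡ (a Fin.zero) (b Fin.zero) _ (e Fin.zero))
          (≡ₚ-*ʳ _ _ (b Fin.zero) (≡ₚ-prodℕ (a ∘ Fin.suc) (b ∘ Fin.suc) (e ∘ Fin.suc)))

  F : Set
  F = Fin p

  toℕ-toF : ∀ m → toℕ (toF p m) ≡ m % p
  toℕ-toF m = toℕ-fromℕ< (m%n<n m p)

  toF-≡ₚ : ∀ {m n} → m ≡ₚ n → toF p m ≡ toF p n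
  toF-≡ₚ {m} {n} e = toℕ-injective (trans (toℕ-toF m) (trans e (sym (toℕ-toF n))))

  toF-toℕ : ∀ (a : F) → toF p (toℕ a) ≡ a
  toF-toℕ a = toℕ-injective (trans (toℕ-toF (toℕ a)) (m<n⇒m%n≡m (toℕ<n a)))

  toℕ-toF-≡ₚ : ∀ m → toℕ (toF p m) ≡ₚ m
  toℕ-toF-≡ₚ m = trans (cong (_% p) (toℕ-toF m)) (≡ₚ-% m)

  0F : F
  0F = toF p 0

  _+F_ : F → F → F
  a +F b = toF p (toℕ a + toℕ b)

  -F_ : F → F
  -F a = toF p (p ∸ toℕ a)

  toF-+ : ∀ m n → toF p (m + n) ≡ toF p m +F toF p n
  toF-+ m n = toF-≡ₚ (trans (≡ₚ-+ˡ m _ n (sym (toℕ-toF-≡ₚ m))) (≡ₚ-+ʳ n _ _ (sym (toℕ-toF-≡ₚ n))))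

  +F-comm : ∀ a b → a +F b ≡ b +F a
  +F-comm a b = cong (toF p) (+-comm (toℕ a) (toℕ b))

  +F-assoc : ∀ a b c → (a +F b) +F c ≡ a +F (b +F c)
  +F-assoc a b c = toF-≡ₚ (begin
    (toℕ (toF p (toℕ a + toℕ b)) + toℕ c) % p  ≡⟨ ≡ₚ-+ˡ _ _ (toℕ c) (toℕ-toF-≡ₚ _) ⟩
    (toℕ a + toℕ b + toℕ c) % p                ≡⟨ cong (_% p) (+-assoc (toℕ a) _ _) ⟩
    (toℕ a + (toℕ b + toℕ c)) % p              ≡⟨ ≡ₚ-+ʳ _ _ (toℕ a) (sym (toℕ-toF-≡ₚ _)) ⟩
    (toℕ a + toℕ (toF p (toℕ b + toℕ c))) % p  ∎)
    where open ≡-Reasoning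

  +F-identityˡ : ∀ a → 0F +F a ≡ a
  +F-identityˡ a = trans (toF-≡ₚ (≡ₚ-+ˡ _ 0 (toℕ a) (toℕ-toF-≡ₚ 0))) (toF-toℕ a)

  +F-inverseʳ : ∀ a → a +F (-F a) ≡ 0F
  +F-inverseʳ a = toF-≡ₚ (begin
    (toℕ a + toℕ (toF p (p ∸ toℕ a))) % p  ≡⟨ ≡ₚ-+ʳ _ _ (toℕ a) (toℕ-toF-≡ₚ _) ⟩
    (toℕ a + (p ∸ toℕ a)) % p              ≡⟨ cong (_% p) (m+[n∸m]≡n (<⇒≤ (toℕ<n a))) ⟩
    p % p                                  ≡⟨ trans (n%n≡0 p) (sym (m<n⇒m%n≡m (ℕ.>-nonZero⁻¹ p))) ⟩
    0 % p                                  ∎)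
    where open ≡-Reasoning

  -F-cancelˡ : ∀ a u → (-F a) +F (a +F u) ≡ u
  -F-cancelˡ a u = begin
    (-F a) +F (a +F u)  ≡⟨ sym (+F-assoc (-F a) a u) ⟩
    ((-F a) +F a) +F u  ≡⟨ cong (_+F u) (trans (+F-comm (-F a) a) (+F-inverseʳ a)) ⟩
    0F +F u             ≡⟨ +F-identityˡ u ⟩
    u                   ∎
    where open ≡-Reasoning

  +F-cancelˡ : ∀ a u → a +F ((-F a) +F u) ≡ u
  +F-cancelˡ a u = begin
    a +F ((-F a) +F u)  ≡⟨ sym (+F-assoc a (-F a) u) ⟩
    (a +F (-F a)) +F u  ≡⟨ cong (_+F u) (+F-inverseʳ a) ⟩
    0F +F u             ≡⟨ +F-identityˡ u ⟩
    u                   ∎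
    where open ≡-Reasoning

  V : Set
  V = List F

  infixl 6 _⊕_
  _⊕_ : V → V → V
  _⊕_ = List.zipWith _+F_

  ⊖_ : V → V
  ⊖_ = map -F_

  zeros : ℕ → V
  zeros m = List.replicate m 0F

  ⊕-assoc : ∀ a b c → (a ⊕ b) ⊕ c ≡ a ⊕ (b ⊕ c)
  ⊕-assoc []      b       c       = refl
  ⊕-assoc (x ∷ a) []      c       = refl
  ⊕-assoc (x ∷ a) (y ∷ b) []      = refl
  ⊕-assoc (x ∷ a) (y ∷ b) (z ∷ c) = cong₂ _∷_ (+F-assoc x y z) (⊕-assoc a b c)

  ⊕-comm : ∀ a b → a ⊕ b ≡ b ⊕ a
  ⊕-comm = zipWith-comm _+F_ +F-comm

  ⊕-identityˡ : ∀ a → zeros (length a) ⊕ a ≡ a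
  ⊕-identityˡ []      = refl
  ⊕-identityˡ (x ∷ a) = cong₂ _∷_ (+F-identityˡ x) (⊕-identityˡ a)

  ⊕-length : ∀ a b → length a ≡ length b → length (a ⊕ b) ≡ length a
  ⊕-length []      b       e  = refl
  ⊕-length (x ∷ a) []      ()
  ⊕-length (x ∷ a) (y ∷ b) e  = cong suc (⊕-length a b (suc-injective e))

  ⊖-cancelˡ : ∀ a u → length a ≡ length u → (⊖ a) ⊕ (a ⊕ u) ≡ u
  ⊖-cancelˡ []      []      e = refl
  ⊖-cancelˡ (x ∷ a) (y ∷ u) e = cong₂ _∷_ (-F-cancelˡ x y) (⊖-cancelˡ a u (suc-injective e))

  ⊕-cancelˡ : ∀ a u → length a ≡ length u → a ⊕ ((⊖ a) ⊕ u) ≡ u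
  ⊕-cancelˡ []      []      e = refl
  ⊕-cancelˡ (x ∷ a) (y ∷ u) e = cong₂ _∷_ (+F-cancelˡ x y) (⊕-cancelˡ a u (suc-injective e))

  ⊕-map : {B : Set} (f g : B → F) (L : List B) → map f L ⊕ map g L ≡ map (λ x → f x +F g x) L
  ⊕-map f g []      = refl
  ⊕-map f g (x ∷ L) = cong (_ ∷_) (⊕-map f g L)

  map-zeros : {B : Set} (L : List B) → map (λ _ → 0F) L ≡ zeros (length L)
  map-zeros []      = refl
  map-zeros (x ∷ L) = cong (0F ∷_) (map-zeros L)

  count-translates : (m : ℕ) (a v : V) → length a ≡ m → length v ≡ m →
                     ∑ (allLists p m) (λ u → 𝟙 ((a ⊕ u) ≟L v)) ≡ 1
  count-translates m a v la lv = trans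
    (∑-congAll (allLists p m) (allLists-length p m) (λ u lu →
      𝟙-cong ((a ⊕ u) ≟L v) (u ≟L ((⊖ a) ⊕ v))
        (λ e → trans (sym (⊖-cancelˡ a u (trans la (sym lu)))) (cong ((⊖ a) ⊕_) e))
        (λ e → trans (cong (a ⊕_) e) (⊕-cancelˡ a v (trans la (sym lv))))))
    (count-allLists p m ((⊖ a) ⊕ v) (trans (⊕-length (⊖ a) v (trans (length-map -F_ a) (trans la (sym lv))))
                                            (trans (length-map -F_ a) la)))

∑< : ℕ → (ℕ → ℕ) → ℕ
∑< zero    f = 0
∑< (suc m) f = f 0 + ∑< m (f ∘ suc)

∑<-cong : ∀ m {f g : ℕ → ℕ} → (∀ j → j < m → f j ≡ g j) → ∑< m f ≡ ∑< m g
∑<-cong zero    e = refl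
∑<-cong (suc m) e = cong₂ _+_ (e 0 (s≤s z≤n)) (∑<-cong m (λ j j<m → e (suc j) (s≤s j<m)))

∑<-zero : ∀ m (f : ℕ → ℕ) → (∀ j → j < m → f j ≡ 0) → ∑< m f ≡ 0
∑<-zero zero    f e = refl
∑<-zero (suc m) f e = cong₂ _+_ (e 0 (s≤s z≤n)) (∑<-zero m (f ∘ suc) (λ j j<m → e (suc j) (s≤s j<m)))

∑<-+ : ∀ m (f g : ℕ → ℕ) → ∑< m (λ j → f j + g j) ≡ ∑< m f + ∑< m g
∑<-+ zero    f g = refl
∑<-+ (suc m) f g =
  trans (cong (f 0 + g 0 +_) (∑<-+ m (f ∘ suc) (g ∘ suc))) (+-interchange (f 0) (g 0) _ _)

∑<-*ˡ : ∀ m c (f : ℕ → ℕ) → ∑< m (λ j → c * f j) ≡ c * ∑< m f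
∑<-*ˡ zero    c f = sym (*-zeroʳ c)
∑<-*ˡ (suc m) c f = trans (cong (c * f 0 +_) (∑<-*ˡ m c (f ∘ suc))) (sym (*-distribˡ-+ c (f 0) _))

∑<-const : ∀ m c → ∑< m (λ _ → c) ≡ m * c
∑<-const zero    c = refl
∑<-const (suc m) c = cong (c +_) (∑<-const m c)

∑<-last : ∀ m (f : ℕ → ℕ) → ∑< (suc m) f ≡ ∑< m f + f m
∑<-last zero    f = +-identityʳ (f 0)
∑<-last (suc m) f = trans (cong (f 0 +_) (∑<-last m (f ∘ suc))) (sym (+-assoc (f 0) _ _))

∑<-swap : ∀ m k (h : ℕ → ℕ → ℕ) → ∑< m (λ i → ∑< k (h i)) ≡ ∑< k (λ j → ∑< m (λ i → h i j))
∑<-swap zero    k h = sym (∑<-zero k _ (λ _ _ → refl))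
∑<-swap (suc m) k h =
  trans (cong (∑< k (h 0) +_) (∑<-swap m k (h ∘ suc))) (sym (∑<-+ k (h 0) (λ j → ∑< m (λ i → h (suc i) j))))

∣-∑< : ∀ {d} m (f : ℕ → ℕ) → (∀ j → j < m → d ∣ f j) → d ∣ ∑< m f
∣-∑< {d} zero    f e = d ∣0
∣-∑<     (suc m) f e = ∣m∣n⇒∣m+n (e 0 (s≤s z≤n)) (∣-∑< m (f ∘ suc) (λ j j<m → e (suc j) (s≤s j<m)))

∑-allFin : ∀ m (f : ℕ → ℕ) → ∑ (allFin m) (f ∘ toℕ) ≡ ∑< m f
∑-allFin zero    f = refl
∑-allFin (suc m) f = trans (∑-allFin-suc m (f ∘ toℕ)) (cong (f 0 +_) (∑-allFin m (f ∘ suc)))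

bin : ℕ → ℕ → ℕ
bin n       zero    = 1
bin zero    (suc k) = 0
bin (suc n) (suc k) = bin n k + bin n (suc k)

bin-big : ∀ n k → n < k → bin n k ≡ 0
bin-big zero    (suc k)       _         = refl
bin-big (suc n) (suc (suc k)) (s≤s n<k) =
  cong₂ _+_ (bin-big n (suc k) n<k) (bin-big n (suc (suc k)) (≤-trans n<k (n≤1+n _)))

bin-diag : ∀ n → bin n n ≡ 1
bin-diag zero    = refl
bin-diag (suc n) = cong₂ _+_ (bin-diag n) (bin-big n (suc n) ≤-refl)

bin-1 : ∀ n → bin n 1 ≡ n
bin-1 zero    = refl
bin-1 (suc n) = cong suc (bin-1 n)

bin-pred : ∀ e → bin (suc e) e ≡ suc e
bin-pred zero    = refl
bin-pred (suc e) = trans (cong₂ _+_ (bin-pred e) (bin-diag (suc e))) (+-comm (suc e) 1)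

bin-absorb : ∀ n k → suc k * bin (suc n) (suc k) ≡ suc n * bin n k
bin-absorb zero    zero    = refl
bin-absorb zero    (suc k) = *-zeroʳ (suc (suc k))
bin-absorb (suc n) zero    = trans (*-identityˡ _) (trans (bin-1 (suc (suc n))) (sym (*-identityʳ _)))
bin-absorb (suc n) (suc k) = begin
  suc (suc k) * (bin (suc n) (suc k) + bin (suc n) (suc (suc k)))
    ≡⟨ *-distribˡ-+ (suc (suc k)) (bin (suc n) (suc k)) _ ⟩
  suc (suc k) * bin (suc n) (suc k) + suc (suc k) * bin (suc n) (suc (suc k))
    ≡⟨ cong (suc (suc k) * bin (suc n) (suc k) +_) (bin-absorb n (suc k)) ⟩
  bin (suc n) (suc k) + suc k * bin (suc n) (suc k) + suc n * bin n (suc k)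
    ≡⟨ cong (λ z → bin (suc n) (suc k) + z + suc n * bin n (suc k)) (bin-absorb n k) ⟩
  bin (suc n) (suc k) + suc n * bin n k + suc n * bin n (suc k)
    ≡⟨ +-assoc (bin (suc n) (suc k)) _ _ ⟩
  bin (suc n) (suc k) + (suc n * bin n k + suc n * bin n (suc k))
    ≡⟨ cong (bin (suc n) (suc k) +_) (sym (*-distribˡ-+ (suc n) (bin n k) _)) ⟩
  bin (suc n) (suc k) + suc n * bin (suc n) (suc k) ∎
  where open ≡-Reasoning

binomial : ∀ t m → suc t ^ m ≡ ∑< (suc m) (λ j → bin m j * t ^ j)
binomial t zero    = refl
binomial t (suc m) = begin
  suc t * suc t ^ m
    ≡⟨ cong (suc t *_) (binomial t m) ⟩
  A + t * A
    ≡⟨ +-comm A (t * A) ⟩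
  t * A + A
    ≡⟨ cong (_+ A) (sym (∑<-*ˡ (suc m) t (λ j → bin m j * t ^ j))) ⟩
  ∑< (suc m) (λ j → t * (bin m j * t ^ j)) + A
    ≡⟨ cong (_+ A) (∑<-cong (suc m) (λ j _ → *-x∙yz≈y∙xz t (bin m j) (t ^ j))) ⟩
  lower + (1 + ∑< m (λ j → bin m (suc j) * t ^ suc j))
    ≡⟨ cong (λ z → lower + (1 + z)) upper-extend ⟩
  lower + (1 + upper)
    ≡⟨ +-suc lower upper ⟩
  1 + (lower + upper)
    ≡⟨ cong (1 +_) (sym (∑<-+ (suc m) (λ j → bin m j * t ^ suc j) (λ j → bin m (suc j) * t ^ suc j))) ⟩
  1 + ∑< (suc m) (λ j → bin m j * t ^ suc j + bin m (suc j) * t ^ suc j)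
    ≡⟨ cong (1 +_) (∑<-cong (suc m) (λ j _ → sym (*-distribʳ-+ (t ^ suc j) (bin m j) (bin m (suc j))))) ⟩
  1 + ∑< (suc m) (λ j → (bin m j + bin m (suc j)) * t ^ suc j)
    ≡⟨ cong (_+ ∑< (suc m) (λ j → (bin m j + bin m (suc j)) * t ^ suc j)) (sym (*-identityʳ 1)) ⟩
  ∑< (suc (suc m)) (λ j → bin (suc m) j * t ^ j) ∎
  where
  open ≡-Reasoning
  A = ∑< (suc m) (λ j → bin m j * t ^ j)
  lower = ∑< (suc m) (λ j → bin m j * t ^ suc j)
  upper = ∑< (suc m) (λ j → bin m (suc j) * t ^ suc j)
  -- the top term C(m, m+1) t^{m+1} vanishes
  upper-extend : ∑< m (λ j → bin m (suc j) * t ^ suc j) ≡ upper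
  upper-extend = sym (trans (∑<-last m _) (trans (cong (∑< m (λ j → bin m (suc j) * t ^ suc j) +_)
                   (cong (_* t ^ suc m) (bin-big m (suc m) ≤-refl))) (+-identityʳ _)))

-- Power sums over 𝔽_p, for a prime p = q + 2.  The weights of the interpolation
-- formula below realise coefficient extraction t^l ↦ [k = l] as a sum of
-- evaluations, which is what makes unit vectors combinations of steps φ(c).
module PowerSums {q : ℕ} (prime : Prime (suc (suc q))) where
  p p-1 : ℕ
  p   = suc (suc q)
  p-1 = suc q
  open Residues {p}

  p∤ : ∀ j → 0 < j → j < p → ¬ (p ∣ j)
  p∤ (suc j) _ j<p p∣j = <⇒≱ j<p (∣⇒≤ p∣j)

  -- p divides C(p, j) for 0 < j < p, by the absorption identity and Euclid.
  p∣bin : ∀ j → 0 < j → j < p → p ∣ bin p j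
  p∣bin (suc k) _ k<p with euclidsLemma (suc k) (bin p (suc k)) prime
                              (divides (bin p-1 k) (trans (bin-absorb p-1 k) (*-comm p (bin p-1 k))))
  ... | inj₁ p∣k = ⊥-elim (p∤ (suc k) (s≤s z≤n) k<p p∣k)
  ... | inj₂ p∣C = p∣C

  -- Fermat's little theorem, by induction on t with the binomial theorem.
  fermat : ∀ t → t ^ p ≡ₚ t
  fermat zero    = refl
  fermat (suc t) = begin
    suc t ^ p % p                         ≡⟨ cong (_% p) (binomial t p) ⟩
    (1 * 1 + ∑< p (f ∘ suc)) % p          ≡⟨ cong (λ z → (1 * 1 + z) % p) (∑<-last p-1 (f ∘ suc)) ⟩
    (1 + (middle + bin p p * t ^ p)) % p  ≡⟨ cong (_% p) (+-x∙yz≈y∙xz 1 middle _) ⟩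
    (middle + (1 + bin p p * t ^ p)) % p  ≡⟨ %-remove-+ˡ (1 + bin p p * t ^ p) p∣middle ⟩
    (1 + bin p p * t ^ p) % p             ≡⟨ cong (λ z → (1 + z * t ^ p) % p) (bin-diag p) ⟩
    (1 + 1 * t ^ p) % p                   ≡⟨ cong (λ z → (1 + z) % p) (*-identityˡ (t ^ p)) ⟩
    (1 + t ^ p) % p                       ≡⟨ ≡ₚ-+ʳ (t ^ p) t 1 (fermat t) ⟩
    suc t % p                             ∎
    where
    open ≡-Reasoning
    f = λ j → bin p j * t ^ j
    middle = ∑< p-1 (f ∘ suc)
    p∣middle : p ∣ middle
    p∣middle = ∣-∑< p-1 _ (λ j j<p-1 → ∣m⇒∣m*n (t ^ suc j) (p∣bin (suc j) (s≤s z≤n) (s≤s j<p-1)))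

  ≡ₚ⇒∣∸ : ∀ x y → y ≤ x → x ≡ₚ y → p ∣ x ∸ y
  ≡ₚ⇒∣∸ x y y≤x e = divides (x / p ∸ y / p) (begin
    x ∸ y                                    ≡⟨ cong₂ _∸_ (m≡m%n+[m/n]*n x p) (m≡m%n+[m/n]*n y p) ⟩
    (x % p + x / p * p) ∸ (y % p + y / p * p) ≡⟨ cong (λ z → (z + x / p * p) ∸ (y % p + y / p * p)) e ⟩
    (y % p + x / p * p) ∸ (y % p + y / p * p) ≡⟨ [m+n]∸[m+o]≡n∸o (y % p) (x / p * p) (y / p * p) ⟩
    x / p * p ∸ y / p * p                    ≡⟨ sym (*-distribʳ-∸ p (x / p) (y / p)) ⟩
    (x / p ∸ y / p) * p                      ∎)
    where open ≡-Reasoning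

  ∣∸⇒≡ₚ : ∀ x y → y ≤ x → p ∣ x ∸ y → x ≡ₚ y
  ∣∸⇒≡ₚ x y y≤x p∣ = trans (cong (_% p) (sym (m+[n∸m]≡n y≤x))) (%-remove-+ʳ y p∣)

  ∣-cancel-unit : ∀ t x → ¬ (p ∣ t) → p ∣ t * x → p ∣ x
  ∣-cancel-unit t x p∤t p∣tx with euclidsLemma t x prime p∣tx
  ... | inj₁ p∣t = ⊥-elim (p∤t p∣t)
  ... | inj₂ p∣x = p∣x

  ≡ₚ-cancelˡ : ∀ t a b → ¬ (p ∣ t) → t * a ≡ₚ t * b → a ≡ₚ b
  ≡ₚ-cancelˡ t a b p∤t e with ≤-total b a
  ... | inj₁ b≤a = ∣∸⇒≡ₚ a b b≤a (∣-cancel-unit t (a ∸ b) p∤t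
                     (subst (p ∣_) (sym (*-distribˡ-∸ t a b)) (≡ₚ⇒∣∸ (t * a) (t * b) (*-monoʳ-≤ t b≤a) e)))
  ... | inj₂ a≤b = sym (∣∸⇒≡ₚ b a a≤b (∣-cancel-unit t (b ∸ a) p∤t
                     (subst (p ∣_) (sym (*-distribˡ-∸ t b a)) (≡ₚ⇒∣∸ (t * b) (t * a) (*-monoʳ-≤ t a≤b) (sym e)))))

  fermat-unit : ∀ t → 0 < t → t < p → t ^ p-1 ≡ₚ 1
  fermat-unit t 0<t t<p =
    ≡ₚ-cancelˡ t (t ^ p-1) 1 (p∤ t 0<t t<p) (trans (fermat t) (cong (_% p) (sym (*-identityʳ t))))

  ∑<-≡ₚ : ∀ m (f g : ℕ → ℕ) → (∀ j → j < m → f j ≡ₚ g j) → ∑< m f ≡ₚ ∑< m g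
  ∑<-≡ₚ zero    f g e = refl
  ∑<-≡ₚ (suc m) f g e = trans (≡ₚ-+ˡ (f 0) (g 0) _ (e 0 (s≤s z≤n)))
                             (≡ₚ-+ʳ _ _ (g 0) (∑<-≡ₚ m (f ∘ suc) (g ∘ suc) (λ j j<m → e (suc j) (s≤s j<m))))

  S : ℕ → ℕ
  S e = ∑< p (λ t → t ^ e)

  -- Telescoping ∑_t ((t+1)^{e+1} - t^{e+1}) = p^{e+1}, expanded binomially.
  telescope : ∀ e → ∑< (suc e) (λ j → bin (suc e) j * S j) ≡ p ^ suc e
  telescope e = +-cancelʳ-≡ (S m) _ _ (begin
    ∑< m g + S m                              ≡⟨ cong (∑< m g +_) (sym (*-identityˡ (S m))) ⟩
    ∑< m g + 1 * S m                          ≡⟨ cong (λ z → ∑< m g + z * S m) (sym (bin-diag m)) ⟩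
    ∑< m g + bin m m * S m                    ≡⟨ sym (∑<-last m g) ⟩
    ∑< (suc m) g                              ≡⟨ ∑<-cong (suc m) (λ j _ → sym (∑<-*ˡ p (bin m j) (λ t → t ^ j))) ⟩
    ∑< (suc m) (λ j → ∑< p (λ t → bin m j * t ^ j)) ≡⟨ sym (∑<-swap p (suc m) (λ t j → bin m j * t ^ j)) ⟩
    ∑< p (λ t → ∑< (suc m) (λ j → bin m j * t ^ j)) ≡⟨ ∑<-cong p (λ t _ → sym (binomial t m)) ⟩
    ∑< p (λ t → suc t ^ m)                    ≡⟨⟩
    ∑< (suc p) (λ t → t ^ m)                  ≡⟨ ∑<-last p (λ t → t ^ m) ⟩
    S m + p ^ m                               ≡⟨ +-comm (S m) _ ⟩
    p ^ m + S m                               ∎)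
    where
    open ≡-Reasoning
    m = suc e
    g = λ j → bin m j * S j

  -- S(e) ≡ 0 for e < p - 1: the telescoping identity expresses (e+1) S(e) through
  -- lower power sums, and e + 1 is a unit.
  S-vanishes : ∀ e → suc e < p → p ∣ S e
  S-vanishes = <-rec _ λ e rec e+1<p → vanish e e+1<p (λ j j<e → rec j<e (<-trans (s≤s j<e) e+1<p))
    where
    vanish : ∀ e → suc e < p → (∀ j → j < e → p ∣ S j) → p ∣ S e
    vanish e e+1<p lower with euclidsLemma (suc e) (S e) prime p∣top
      where
      split : ∑< e (λ j → bin (suc e) j * S j) + suc e * S e ≡ p ^ suc e
      split = trans (cong (∑< e (λ j → bin (suc e) j * S j) +_) (cong (_* S e) (sym (bin-pred e))))
                    (trans (sym (∑<-last e (λ j → bin (suc e) j * S j))) (telescope e))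
      p∣top : p ∣ suc e * S e
      p∣top = ∣m+n∣m⇒∣n (subst (p ∣_) (sym split) (∣m⇒∣m*n (p ^ e) ∣-refl))
                        (∣-∑< e _ (λ j j<e → ∣n⇒∣m*n (bin (suc e) j) (lower j j<e)))
    ... | inj₁ p∣e+1 = ⊥-elim (p∤ (suc e) (s≤s z≤n) e+1<p p∣e+1)
    ... | inj₂ p∣S   = p∣S

  S-top : S p-1 ≡ₚ p-1
  S-top = trans (∑<-≡ₚ p-1 (λ t → suc t ^ p-1) (λ _ → 1) (λ t t<p-1 → fermat-unit (suc t) (s≤s z≤n) (s≤s t<p-1)))
                (cong (_% p) (trans (∑<-const p-1 1) (*-identityʳ p-1)))

  S-periodic : ∀ d → S (p-1 + suc d) ≡ₚ S (suc d)
  S-periodic d = ∑<-≡ₚ p (λ t → t ^ (p-1 + suc d)) (λ t → t ^ suc d) λ t _ → begin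
    t ^ (p-1 + suc d) % p  ≡⟨ cong (λ z → t ^ z % p) (+-suc p-1 d) ⟩
    t ^ (p + d) % p        ≡⟨ cong (_% p) (^-distribˡ-+-* t p d) ⟩
    (t ^ p * t ^ d) % p    ≡⟨ ≡ₚ-*ˡ (t ^ p) t (t ^ d) (fermat t) ⟩
    (t * t ^ d) % p        ∎
    where open ≡-Reasoning

  weight : ℕ → ℕ → ℕ
  weight zero    zero    = 1
  weight zero    (suc t) = 0
  weight (suc k) t       = p-1 * t ^ (p-1 ∸ suc k)

  -- Coefficient extraction: ∑_t w_k(t) t^l ≡ [k = l] for k, l < p.
  extract : ℕ → ℕ → ℕ
  extract k l = ∑< p (λ t → weight k t * t ^ l)

  extract-suc : ∀ k l → extract (suc k) l ≡ p-1 * S ((p-1 ∸ suc k) + l)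
  extract-suc k l = trans (∑<-cong p (λ t _ → trans (*-assoc p-1 (t ^ (p-1 ∸ suc k)) (t ^ l))
                                                    (cong (p-1 *_) (sym (^-distribˡ-+-* t (p-1 ∸ suc k) l)))))
                          (∑<-*ˡ p p-1 (λ t → t ^ ((p-1 ∸ suc k) + l)))

  extract-≡ₚ : ∀ k l → k < p → l < p → extract k l ≡ₚ 𝟙 (k ≟ l)
  extract-≡ₚ zero    zero    _ _ = cong (_% p) (cong suc (∑<-zero p-1 _ (λ _ _ → refl)))
  extract-≡ₚ zero    (suc l) _ _ = cong (_% p) (∑<-zero p (λ t → weight 0 t * t ^ suc l) (λ { zero _ → refl ; (suc t) _ → refl }))
  extract-≡ₚ (suc k) l k<p l<p = trans (cong (_% p) (extract-suc k l)) (by-cases (<-cmp l (suc k)))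
    where
    k≤p-1 : suc k ≤ p-1
    k≤p-1 = ℕ.s≤s⁻¹ k<p
    e = (p-1 ∸ suc k) + l
    off-diagonal : ∀ {x} → p ∣ S x → ¬ (suc k ≡ l) → (p-1 * S x) % p ≡ 𝟙 (suc k ≟ l) % p
    off-diagonal {x} p∣S k≠l = trans (≡ₚ-*ʳ (S x) 0 p-1 (n∣m⇒m%n≡0 (S x) p p∣S))
                                     (cong (_% p) (trans (*-zeroʳ p-1) (sym (𝟙-no (suc k ≟ l) k≠l))))
    by-cases : Tri (l < suc k) (l ≡ suc k) (suc k < l) → (p-1 * S e) % p ≡ 𝟙 (suc k ≟ l) % p
    -- below the diagonal the exponent e is less than p - 1
    by-cases (tri< l<k _ _) = off-diagonal {e} (S-vanishes e (s≤s e<p-1)) (λ k≡l → <-irrefl (sym k≡l) l<k)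
      where
      e<p-1 : e < p-1
      e<p-1 = subst (e <_) (m∸n+n≡m k≤p-1) (+-monoʳ-< (p-1 ∸ suc k) l<k)
    -- on the diagonal (p - 1) S(p - 1) ≡ (p - 1)² ≡ 1
    by-cases (tri≈ _ refl _) = begin
      (p-1 * S e) % p     ≡⟨ cong (λ z → (p-1 * S z) % p) (m∸n+n≡m k≤p-1) ⟩
      (p-1 * S p-1) % p   ≡⟨ ≡ₚ-*ʳ (S p-1) p-1 p-1 S-top ⟩
      (p-1 * p-1) % p     ≡⟨ cong (_% p) (square q) ⟩
      (1 + q * p) % p     ≡⟨ [m+kn]%n≡m%n 1 q p ⟩
      1 % p               ≡⟨ cong (_% p) (sym (𝟙-yes (suc k ≟ suc k) refl)) ⟩
      𝟙 (suc k ≟ suc k) % p ∎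
      where
      open ≡-Reasoning
      square : ∀ q → suc q * suc q ≡ 1 + q * suc (suc q)
      square = solve-∀
    -- above the diagonal e = (p - 1) + d with 0 < d < p - 1
    by-cases (tri> _ _ k<l) with m≤n⇒∃[o]m+o≡n k<l
    ... | d , refl = off-diagonal {e} (subst (λ x → p ∣ S x) (sym e≡) p∣S) (λ k≡l → <-irrefl k≡l k<l)
      where
      e≡ : e ≡ p-1 + suc d
      e≡ = trans (cong ((p-1 ∸ suc k) +_) (sym (+-suc (suc k) d)))
             (trans (sym (+-assoc (p-1 ∸ suc k) (suc k) (suc d))) (cong (_+ suc d) (m∸n+n≡m k≤p-1)))
      d+2<p : suc (suc d) < p
      d+2<p = ≤-trans (s≤s (s≤s (s≤s (m≤n+m d k)))) l<p
      p∣S : p ∣ S (p-1 + suc d)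
      p∣S = m%n≡0⇒n∣m _ p (trans (S-periodic d) (n∣m⇒m%n≡0 _ p (S-vanishes (suc d) d+2<p)))

-- The random walk.  Throughout, n and p are fixed, a point of 𝔽^n is a function
-- c : Fin n → Fin p, and vectors of 𝔽^K are indexed along the enumeration 𝒦 n p.
module Walk (n : ℕ) {p : ℕ} .{{_ : NonZero p}} where
  open Residues {p}

  Pt : Set
  Pt = Fin n → Fin p

  pts : List Pt
  pts = allFuns n (allFin p)

  𝔽ᴷ : List V
  𝔽ᴷ = allLists p (K n p)

  mono : Pt → Pt → ℕ
  mono c κ = prodℕ (λ i → toℕ (c i) ^ toℕ (κ i))

  φ : Pt → V
  φ c = map (λ κ → toF p (mono c κ)) (𝒦 n p)

  o : V
  o = map (λ _ → 0F) (𝒦 n p)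

  length-φ : ∀ c → length (φ c) ≡ K n p
  length-φ c = length-map _ (𝒦 n p)

  length-X : ∀ N r → length (X n p N r) ≡ K n p
  length-X N r = length-map _ (𝒦 n p)

  length-o : length o ≡ K n p
  length-o = length-map _ (𝒦 n p)

  o⊕ : ∀ w → length w ≡ K n p → o ⊕ w ≡ w
  o⊕ w len = trans (cong (_⊕ w) (trans (map-zeros (𝒦 n p)) (cong zeros (sym len)))) (⊕-identityˡ w)

  φ-cong : ∀ c c' → (∀ i → c i ≡ c' i) → φ c ≡ φ c'
  φ-cong c c' e = map-cong (λ κ → cong (toF p) (prodℕ-cong (λ i → cong (λ t → toℕ t ^ toℕ (κ i)) (e i)))) (𝒦 n p)

  X-cong : ∀ N (r r' : Fin n → Fin N → Fin p) → (∀ i j → r i j ≡ r' i j) → X n p N r ≡ X n p N r'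
  X-cong N r r' e = map-cong (λ κ → cong (toF p) (sumℕ-cong (λ j → prodℕ-cong (λ i →
                      cong (λ t → toℕ t ^ toℕ (κ i)) (e i j))))) (𝒦 n p)

  X-step : ∀ N c r → X n p (suc N) (λ i → c i ◂ r i) ≡ X n p N r ⊕ φ c
  X-step N c r = sym (trans (⊕-map _ _ (𝒦 n p)) (map-cong (λ κ →
    trans (sym (toF-+ _ (mono c κ))) (cong (toF p) (+-comm _ (mono c κ)))) (𝒦 n p)))

  hits : ℕ → V → V → ℕ
  hits N w v = ∑ (samples n p N) (λ r → 𝟙 ((X n p N r ⊕ w) ≟L v))

  #samples : ℕ → ℕ
  #samples N = length (samples n p N)

  hits-suc : ∀ N w v → hits (suc N) w v ≡ ∑ pts (λ c → hits N (φ c ⊕ w) v)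
  hits-suc N w v = trans
    (∑-allFuns-grid n (allFin p) (allFuns N (allFin p)) _ _
      (λ r r' e → cong (λ z → 𝟙 ((z ⊕ w) ≟L v)) (X-cong (suc N) r r' (λ i j → cong (λ f → f j) (e i)))))
    (∑-cong pts (λ c → ∑-cong (samples n p N) (λ r → cong (λ z → 𝟙 (z ≟L v))
      (trans (cong (_⊕ w) (X-step N c r)) (⊕-assoc (X n p N r) (φ c) w)))))

  walks : (M : ℕ) → List (Fin M → Pt)
  walks M = allFuns M pts

  endpoint : {M : ℕ} → (Fin M → Pt) → V
  endpoint {zero}  s = o
  endpoint {suc M} s = endpoint (s ∘ Fin.suc) ⊕ φ (s Fin.zero)

  endpoint-cong : ∀ M (s s' : Fin M → Pt) → (∀ i j → s i j ≡ s' i j) → endpoint s ≡ endpoint s'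
  endpoint-cong zero    s s' e = refl
  endpoint-cong (suc M) s s' e = cong₂ _⊕_ (endpoint-cong M _ _ (e ∘ Fin.suc)) (φ-cong _ _ (e Fin.zero))

  length-endpoint : ∀ M (s : Fin M → Pt) → length (endpoint s) ≡ K n p
  length-endpoint zero    s = length-o
  length-endpoint (suc M) s =
    trans (⊕-length (endpoint (s ∘ Fin.suc)) _ (trans (length-endpoint M _) (sym (length-φ _)))) (length-endpoint M _)

  visits : ℕ → V → ℕ
  visits M u = ∑ (walks M) (λ s → 𝟙 (endpoint s ≟L u))

  hits-+ : ∀ M N w v → length w ≡ K n p → hits (M + N) w v ≡ ∑ (walks M) (λ s → hits N (endpoint s ⊕ w) v)
  hits-+ zero    N w v len = trans (cong (λ z → hits N z v) (sym (o⊕ w len))) (sym (+-identityʳ _))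
  hits-+ (suc M) N w v len = begin
    hits (suc (M + N)) w v
      ≡⟨ hits-suc (M + N) w v ⟩
    ∑ pts (λ c → hits (M + N) (φ c ⊕ w) v)
      ≡⟨ ∑-cong pts (λ c → hits-+ M N (φ c ⊕ w) v (trans (⊕-length (φ c) w (trans (length-φ c) (sym len))) (length-φ c))) ⟩
    ∑ pts (λ c → ∑ (walks M) (λ s → hits N (endpoint s ⊕ (φ c ⊕ w)) v))
      ≡⟨ ∑-cong pts (λ c → ∑-cong (walks M) (λ s → cong (λ z → hits N z v) (sym (⊕-assoc (endpoint s) (φ c) w)))) ⟩
    ∑ pts (λ c → ∑ (walks M) (λ s → hits N (endpoint (c ◂ s) ⊕ w) v))
      ≡⟨ sym (∑-allFuns-suc _≗_ (λ _ _ → refl) M pts (λ s → hits N (endpoint s ⊕ w) v)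
              (λ s s' e → cong (λ z → hits N (z ⊕ w) v) (endpoint-cong (suc M) s s' e))) ⟩
    ∑ (walks (suc M)) (λ s → hits N (endpoint s ⊕ w) v) ∎
    where open ≡-Reasoning

  count : ℕ → V → ℕ
  count N v = length (filter (λ r → ≡-dec _≟F_ (X n p N r) v) (samples n p N))

  count≡hits : ∀ N v → count N v ≡ hits N o v
  count≡hits N v = trans (length-filter (λ r → ≡-dec _≟F_ (X n p N r) v) (samples n p N))
    (∑-cong (samples n p N) (λ r → cong (λ z → 𝟙 (z ≟L v))
      (sym (trans (⊕-comm (X n p N r) o) (o⊕ (X n p N r) (length-X N r))))))

  ∑-count : ∀ N → ∑ 𝔽ᴷ (count N) ≡ #samples N
  ∑-count N = begin
    ∑ 𝔽ᴷ (count N)                                                       ≡⟨ ∑-cong 𝔽ᴷ (count≡hits N) ⟩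
    ∑ 𝔽ᴷ (hits N o)                                                      ≡⟨ ∑-swap 𝔽ᴷ (samples n p N) _ ⟩
    ∑ (samples n p N) (λ r → ∑ 𝔽ᴷ (λ v → 𝟙 ((X n p N r ⊕ o) ≟L v)))      ≡⟨ ∑-cong (samples n p N) (λ r → one-target r) ⟩
    ∑ (samples n p N) (λ _ → 1)                                          ≡⟨ sym (length≡∑1 (samples n p N)) ⟩
    #samples N                                                           ∎
    where
    open ≡-Reasoning
    one-target : ∀ r → ∑ 𝔽ᴷ (λ v → 𝟙 ((X n p N r ⊕ o) ≟L v)) ≡ 1
    one-target r = trans (∑-cong 𝔽ᴷ (λ v → 𝟙-cong ((X n p N r ⊕ o) ≟L v) (v ≟L (X n p N r ⊕ o)) sym sym))
      (count-allLists p (K n p) _ (trans (⊕-length (X n p N r) o (trans (length-X N r) (sym length-o))) (length-X N r)))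

  #samples≡ : ∀ N → #samples N ≡ p ^ (n * N)
  #samples≡ N = trans (length-allFuns n _) (trans (cong (_^ n) (trans (length-allFuns N (allFin p))
                  (cong (_^ N) (length-tabulate {n = p} (λ i → i))))) (trans (^-*-assoc p N n) (cong (p ^_) (*-comm N n))))

  ∑-hits-translates : ∀ N w v → length w ≡ K n p → length v ≡ K n p →
                      ∑ 𝔽ᴷ (λ u → hits N (u ⊕ w) v) ≡ #samples N
  ∑-hits-translates N w v lw lv = begin
    ∑ 𝔽ᴷ (λ u → hits N (u ⊕ w) v)
      ≡⟨ ∑-swap 𝔽ᴷ (samples n p N) _ ⟩
    ∑ (samples n p N) (λ r → ∑ 𝔽ᴷ (λ u → 𝟙 ((X n p N r ⊕ (u ⊕ w)) ≟L v)))
      ≡⟨ ∑-cong (samples n p N) (λ r → ∑-cong 𝔽ᴷ (λ u → cong (λ z → 𝟙 (z ≟L v))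
           (trans (cong (X n p N r ⊕_) (⊕-comm u w)) (sym (⊕-assoc (X n p N r) w u))))) ⟩
    ∑ (samples n p N) (λ r → ∑ 𝔽ᴷ (λ u → 𝟙 (((X n p N r ⊕ w) ⊕ u) ≟L v)))
      ≡⟨ ∑-cong (samples n p N) (λ r → count-translates (K n p) (X n p N r ⊕ w) v
           (trans (⊕-length (X n p N r) w (trans (length-X N r) (sym lw))) (length-X N r)) lv) ⟩
    ∑ (samples n p N) (λ _ → 1)
      ≡⟨ sym (length≡∑1 (samples n p N)) ⟩
    #samples N ∎
    where open ≡-Reasoning

module Doeblin (n : ℕ) {p : ℕ} .{{_ : NonZero p}} where
  open Residues {p}
  open Walk n {p}

  Q : ℕ
  Q = length 𝔽ᴷ

  #samples-+ : ∀ M N → #samples (M + N) ≡ length (walks M) * #samples N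
  #samples-+ M N = begin
    #samples (M + N)                 ≡⟨ length-allFuns n _ ⟩
    length (allFuns (M + N) 𝔽ₚ) ^ n  ≡⟨ cong (_^ n) (length-allFuns (M + N) 𝔽ₚ) ⟩
    (ℓ ^ (M + N)) ^ n                ≡⟨ cong (_^ n) (^-distribˡ-+-* ℓ M N) ⟩
    (ℓ ^ M * ℓ ^ N) ^ n              ≡⟨ ^-distribʳ-* (ℓ ^ M) (ℓ ^ N) n ⟩
    (ℓ ^ M) ^ n * (ℓ ^ N) ^ n        ≡⟨ cong (_* (ℓ ^ N) ^ n) (^-comm ℓ M n) ⟩
    (ℓ ^ n) ^ M * (ℓ ^ N) ^ n        ≡⟨ sym (cong₂ _*_ (trans (length-allFuns M pts) (cong (_^ M) (length-allFuns n 𝔽ₚ)))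
                                                     (trans (length-allFuns n _) (cong (_^ n) (length-allFuns N 𝔽ₚ)))) ⟩
    length (walks M) * #samples N    ∎
    where
    open ≡-Reasoning
    𝔽ₚ = allFin p
    ℓ = length 𝔽ₚ

  -- The defect bound with defect A: Q · hits_N(w, v) ≥ #samples N - A for all w, v,
  -- i.e. every target gets at least its uniform share of the samples, up to A.
  DefectBound : ℕ → ℕ → Set
  DefectBound N A = ∀ w v → length w ≡ K n p → length v ≡ K n p → #samples N ≤ Q * hits N w v + A

  defect-trivial : ∀ N → DefectBound N (#samples N)
  defect-trivial N w v _ _ = m≤n+m (#samples N) _

  -- If every vector is the endpoint of some walk of length M, the walks of
  -- length M consist of one walk to each vector plus `excess` further walks.
  module Contraction (M : ℕ) (reach : All (λ u → 1 ≤ visits M u) 𝔽ᴷ) where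

    excess : ℕ
    excess = ∑ 𝔽ᴷ (λ u → visits M u ∸ 1)

    walks-split : Q + excess ≡ length (walks M)
    walks-split = begin
      Q + excess                             ≡⟨ cong (_+ excess) (length≡∑1 𝔽ᴷ) ⟩
      ∑ 𝔽ᴷ (λ _ → 1) + excess                ≡⟨ sym (∑-+ 𝔽ᴷ _ _) ⟩
      ∑ 𝔽ᴷ (λ u → 1 + (visits M u ∸ 1))      ≡⟨ ∑-congAll 𝔽ᴷ reach (λ u r → m+[n∸m]≡n r) ⟩
      ∑ 𝔽ᴷ (λ u → visits M u)                ≡⟨ ∑-cong 𝔽ᴷ (λ u → sym (*-identityʳ _)) ⟩
      ∑ 𝔽ᴷ (λ u → visits M u * 1)            ≡⟨ sym (∑-fibres p (K n p) (walks M) endpoint (λ _ → 1) (length-endpoint M)) ⟩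
      ∑ (walks M) (λ _ → 1)                  ≡⟨ sym (length≡∑1 (walks M)) ⟩
      length (walks M)                       ∎
      where open ≡-Reasoning

    ≤-copies : ∀ k x B → 1 ≤ k → B ≤ x → x + (k ∸ 1) * B ≤ k * x
    ≤-copies (suc k) x B _ B≤x = +-monoʳ-≤ x (*-monoʳ-≤ k B≤x)

    -- Every walk of length M contributes the bound at N; the surplus walks
    -- contribute the part #samples N - A guaranteed by the defect bound.
    hits-lower : ∀ N A → DefectBound N A → ∀ w v → length w ≡ K n p → length v ≡ K n p →
                 Q * #samples N + excess * (#samples N ∸ A) ≤ Q * hits (M + N) w v
    hits-lower N A bound w v lw lv = begin
      Q * T + excess * B
        ≡⟨ cong₂ _+_ (cong (Q *_) (sym (∑-hits-translates N w v lw lv))) (sym (∑-*ʳ 𝔽ᴷ B _)) ⟩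
      Q * ∑ 𝔽ᴷ c + ∑ 𝔽ᴷ (λ u → (visits M u ∸ 1) * B)
        ≡⟨ cong (_+ ∑ 𝔽ᴷ (λ u → (visits M u ∸ 1) * B)) (sym (∑-*ˡ 𝔽ᴷ Q c)) ⟩
      ∑ 𝔽ᴷ (λ u → Q * c u) + ∑ 𝔽ᴷ (λ u → (visits M u ∸ 1) * B)
        ≡⟨ sym (∑-+ 𝔽ᴷ _ _) ⟩
      ∑ 𝔽ᴷ (λ u → Q * c u + (visits M u ∸ 1) * B)
        ≤⟨ ∑-monoAll 𝔽ᴷ (All.zip (reach , allLists-length p (K n p))) (λ u (r , lu) →
             ≤-copies (visits M u) (Q * c u) B r (m≤n+o⇒m∸n≤o T A (subst (T ≤_) (+-comm (Q * c u) A)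
               (bound (u ⊕ w) v (trans (⊕-length u w (trans lu (sym lw))) lu) lv)))) ⟩
      ∑ 𝔽ᴷ (λ u → visits M u * (Q * c u))
        ≡⟨ sym (∑-fibres p (K n p) (walks M) endpoint (λ u → Q * c u) (length-endpoint M)) ⟩
      ∑ (walks M) (λ s → Q * c (endpoint s))
        ≡⟨ ∑-*ˡ (walks M) Q _ ⟩
      Q * ∑ (walks M) (λ s → hits N (endpoint s ⊕ w) v)
        ≡⟨ cong (Q *_) (sym (hits-+ M N w v lw)) ⟩
      Q * hits (M + N) w v ∎
      where
      open ≤-Reasoning
      T = #samples N
      B = T ∸ A
      c : V → ℕ
      c u = hits N (u ⊕ w) v

    contract : ∀ N A → DefectBound N A → DefectBound (M + N) (excess * A)
    contract N A bound w v lw lv = begin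
      #samples (M + N)                            ≡⟨ #samples-+ M N ⟩
      length (walks M) * T                        ≡⟨ cong (_* T) (sym walks-split) ⟩
      (Q + excess) * T                            ≡⟨ *-distribʳ-+ T Q excess ⟩
      Q * T + excess * T                          ≤⟨ +-monoʳ-≤ (Q * T) (*-monoʳ-≤ excess (m≤n+m∸n T A)) ⟩
      Q * T + excess * (A + (T ∸ A))              ≡⟨ regroup (Q * T) excess A (T ∸ A) ⟩
      Q * T + excess * (T ∸ A) + excess * A       ≤⟨ +-monoˡ-≤ (excess * A) (hits-lower N A bound w v lw lv) ⟩
      Q * hits (M + N) w v + excess * A           ∎
      where
      open ≤-Reasoning
      T = #samples N
      regroup : ∀ a e x y → a + e * (x + y) ≡ a + e * y + e * x
      regroup = solve-∀

    contract-blocks : ∀ j r → DefectBound (j * M + r) (excess ^ j * #samples r)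
    contract-blocks zero    r = subst (λ A → DefectBound r A) (sym (+-identityʳ (#samples r))) (defect-trivial r)
    contract-blocks (suc j) r = subst₂ DefectBound (sym (+-assoc M (j * M) r)) (sym (*-assoc excess (excess ^ j) (#samples r)))
                                  (contract (j * M + r) (excess ^ j * #samples r) (contract-blocks j r))

    #samples-blocks : ∀ j r → #samples (j * M + r) ≡ (Q + excess) ^ j * #samples r
    #samples-blocks zero    r = sym (+-identityʳ (#samples r))
    #samples-blocks (suc j) r = begin
      #samples (M + j * M + r)                  ≡⟨ cong #samples (+-assoc M (j * M) r) ⟩
      #samples (M + (j * M + r))                ≡⟨ #samples-+ M (j * M + r) ⟩
      length (walks M) * #samples (j * M + r)   ≡⟨ cong₂ _*_ (sym walks-split) (#samples-blocks j r) ⟩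
      (Q + excess) * ((Q + excess) ^ j * #samples r) ≡⟨ sym (*-assoc (Q + excess) _ (#samples r)) ⟩
      (Q + excess) ^ suc j * #samples r         ∎
      where open ≡-Reasoning

module Spanning (n : ℕ) {q : ℕ} (prime : Prime (suc (suc q))) where
  open PowerSums prime
  open Residues {p}
  open Walk n {p}

  dual : Pt → Pt → ℕ
  dual κ₀ κ = ∑ pts (λ c → prodℕ (λ i → weight (toℕ (κ₀ i)) (toℕ (c i))) * mono c κ)

  δ : ∀ {m} → (Fin m → Fin p) → (Fin m → Fin p) → ℕ
  δ κ₀ κ = prodℕ (λ i → 𝟙 (toℕ (κ₀ i) ≟ toℕ (κ i)))

  dual-factorises : ∀ κ₀ κ → dual κ₀ κ ≡ prodℕ (λ i → extract (toℕ (κ₀ i)) (toℕ (κ i)))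
  dual-factorises κ₀ κ = begin
    dual κ₀ κ
      ≡⟨ ∑-cong pts (λ c → prodℕ-* (λ i → weight (toℕ (κ₀ i)) (toℕ (c i))) (λ i → toℕ (c i) ^ toℕ (κ i))) ⟩
    ∑ pts (λ c → prodℕ (λ i → weight (toℕ (κ₀ i)) (toℕ (c i)) * toℕ (c i) ^ toℕ (κ i)))
      ≡⟨ ∑-allFuns-prodℕ n (allFin p) (λ i t → weight (toℕ (κ₀ i)) (toℕ t) * toℕ t ^ toℕ (κ i)) ⟩
    prodℕ (λ i → ∑ (allFin p) (λ t → weight (toℕ (κ₀ i)) (toℕ t) * toℕ t ^ toℕ (κ i)))
      ≡⟨ prodℕ-cong (λ i → ∑-allFin p (λ t → weight (toℕ (κ₀ i)) t * t ^ toℕ (κ i))) ⟩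
    prodℕ (λ i → extract (toℕ (κ₀ i)) (toℕ (κ i))) ∎
    where open ≡-Reasoning

  dual-≡ₚ : ∀ κ₀ κ → dual κ₀ κ ≡ₚ δ κ₀ κ
  dual-≡ₚ κ₀ κ = trans (cong (_% p) (dual-factorises κ₀ κ))
                       (≡ₚ-prodℕ _ _ (λ i → extract-≡ₚ _ _ (toℕ<n (κ₀ i)) (toℕ<n (κ i))))

  δ-diag : ∀ {m} (a b : Fin m → Fin p) → (∀ i → a i ≡ b i) → δ a b ≡ 1
  δ-diag {zero}  a b a≗b = refl
  δ-diag {suc m} a b a≗b = cong₂ _*_ (𝟙-yes (toℕ (a Fin.zero) ≟ toℕ (b Fin.zero)) (cong toℕ (a≗b Fin.zero)))
                                     (δ-diag (a ∘ Fin.suc) (b ∘ Fin.suc) (a≗b ∘ Fin.suc))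

  δ-off : ∀ {m} (a b : Fin m → Fin p) → Distinct a b → δ a b ≡ 0
  δ-off {zero}  a b a≠b = ⊥-elim (a≠b (λ ()))
  δ-off {suc m} a b a≠b with toℕ (a Fin.zero) ≟ toℕ (b Fin.zero)
  ... | no _   = refl
  ... | yes a₀≡b₀ = trans (+-identityʳ _) (δ-off (a ∘ Fin.suc) (b ∘ Fin.suc)
                      (λ a≗b → a≠b (λ { Fin.zero → toℕ-injective a₀≡b₀ ; (Fin.suc i) → a≗b i })))

  data Reach : ℕ → V → Set where
    start : Reach 0 o
    step  : ∀ {M u} c → c ∈ pts → Reach M u → Reach (suc M) (u ⊕ φ c)

  length-Reach : ∀ {M u} → Reach M u → length u ≡ K n p
  length-Reach start = length-o
  length-Reach (step {u = u} c _ r) =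
    trans (⊕-length u (φ c) (trans (length-Reach r) (sym (length-φ c)))) (length-Reach r)

  Reach⇒visits : ∀ {M u} → Reach M u → 1 ≤ visits M u
  Reach⇒visits start = ≤-reflexive (sym (cong (_+ 0) (𝟙-yes (o ≟L o) refl)))
  Reach⇒visits {suc M} (step {u = u} c c∈ r) = begin
    1                                                               ≤⟨ Reach⇒visits r ⟩
    ∑ (walks M) (λ s → 𝟙 (endpoint s ≟L u))                         ≤⟨ ∑-mono (walks M) (λ s →
                                                                         𝟙-mono (endpoint s ≟L u) _ (cong (_⊕ φ c))) ⟩
    ∑ (walks M) (λ s → 𝟙 ((endpoint s ⊕ φ c) ≟L (u ⊕ φ c)))          ≤⟨ term≤∑ pts (λ c' → ∑ (walks M) (λ s →
                                                                         𝟙 ((endpoint s ⊕ φ c') ≟L (u ⊕ φ c)))) c∈ ⟩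
    ∑ pts (λ c' → ∑ (walks M) (λ s → 𝟙 ((endpoint s ⊕ φ c') ≟L (u ⊕ φ c))))
                                                                    ≡⟨ sym (∑-allFuns-suc _≗_ (λ _ _ → refl) M pts _
                                                                         (λ s s' e → cong (λ z → 𝟙 (z ≟L (u ⊕ φ c)))
                                                                           (endpoint-cong (suc M) s s' e))) ⟩
    visits (suc M) (u ⊕ φ c)                                        ∎
    where open ≤-Reasoning

  Reach-⊕ : ∀ {M M' u u'} → Reach M u → Reach M' u' → Reach (M' + M) (u ⊕ u')
  Reach-⊕ {u = u} r start = subst (Reach _) (sym (trans (⊕-comm u o) (o⊕ u (length-Reach r)))) r
  Reach-⊕ {u = u} r (step {u = u'} c c∈ r') = subst (Reach _) (⊕-assoc u u' (φ c)) (step c c∈ (Reach-⊕ r r'))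

  -- φ(0) = 0 because every κ ∈ 𝒦 has a positive exponent, so walks can be padded
  -- with the point 0.
  zero-point : Σ Pt λ c₀ → c₀ ∈ pts × (∀ i → c₀ i ≡ Fin.zero)
  zero-point = allFuns-complete n (allFin p) (λ _ → Fin.zero) (λ _ → ∈-allFin Fin.zero)

  φ-zero : φ (proj₁ zero-point) ≡ o
  φ-zero = map-cong-local (All.map (λ { {κ} (i , kᵢ≠0) → cong (toF p)
             (prodℕ-zero _ i (trans (cong (λ z → toℕ z ^ toℕ (κ i)) (proj₂ (proj₂ zero-point) i))
                                    (0^-positive (toℕ (κ i)) kᵢ≠0))) })
           (AllP.all-filter nonzero? (allFuns n (allFin p))))
    where
    0^-positive : ∀ k → ¬ k ≡ 0 → 0 ^ k ≡ 0
    0^-positive zero    k≠0 = ⊥-elim (k≠0 refl)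
    0^-positive (suc k) _   = refl

  Reach-pad : ∀ {M u} d → Reach M u → Reach (d + M) u
  Reach-pad zero    r = r
  Reach-pad {u = u} (suc d) r = subst (Reach _) padded (step c₀ c₀∈ (Reach-pad d r))
    where
    c₀  = proj₁ zero-point
    c₀∈ = proj₁ (proj₂ zero-point)
    padded : u ⊕ φ c₀ ≡ u
    padded = trans (cong (u ⊕_) φ-zero) (trans (⊕-comm u o) (o⊕ u (length-Reach (Reach-pad d r))))

  vec : (Pt → ℕ) → V
  vec F = map (λ κ → toF p (F κ)) (𝒦 n p)

  Reachable : (Pt → ℕ) → Set
  Reachable F = Σ ℕ λ M → Reach M (vec F)

  reachable-0 : Reachable (λ _ → 0)
  reachable-0 = 0 , start

  reachable-+ : ∀ {F G} → Reachable F → Reachable G → Reachable (λ κ → F κ + G κ)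
  reachable-+ {F} {G} (M , r) (M' , r') = M' + M , subst (Reach _)
    (trans (⊕-map _ _ (𝒦 n p)) (map-cong (λ κ → sym (toF-+ (F κ) (G κ))) (𝒦 n p))) (Reach-⊕ r r')

  reachable-* : ∀ {F} k → Reachable F → Reachable (λ κ → k * F κ)
  reachable-* zero    r = reachable-0
  reachable-* {F} (suc k) r = reachable-+ {F} {λ κ → k * F κ} r (reachable-* k r)

  reachable-mono : ∀ c → c ∈ pts → Reachable (mono c)
  reachable-mono c c∈ = 1 , subst (Reach 1) (o⊕ (φ c) (length-φ c)) (step c c∈ start)

  reachable-dual : ∀ κ₀ → Reachable (dual κ₀)
  reachable-dual κ₀ = combination pts (All.tabulate (λ c∈ → c∈))
    where
    w : Pt → ℕ
    w c = prodℕ (λ i → weight (toℕ (κ₀ i)) (toℕ (c i)))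
    combination : ∀ cs → All (_∈ pts) cs → Reachable (λ κ → ∑ cs (λ c → w c * mono c κ))
    combination []       []         = reachable-0
    combination (c ∷ cs) (c∈ ∷ cs∈) = reachable-+ {λ κ → w c * mono c κ} {λ κ → ∑ cs (λ c' → w c' * mono c' κ)}
                                        (reachable-* {mono c} (w c) (reachable-mono c c∈)) (combination cs cs∈)

  -- Every vector indexed along a list of pairwise distinct exponents is reachable:
  -- β copies of dual κ₀ set the coordinate κ₀ to any value, leaving the others alone.
  reachable-any : ∀ (L : List Pt) → AllPairs Distinct L → ∀ v → length v ≡ length L →
                  Σ (Pt → ℕ) λ G → Reachable G × map (λ κ → toF p (G κ)) L ≡ v
  reachable-any []       _              []      _   = (λ _ → 0) , reachable-0 , refl
  reachable-any (κ₀ ∷ L) (κ₀∉L ∷ dist) (a ∷ v) len with reachable-any L dist v (suc-injective len)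
  ... | G , rG , G≡v = G' , reachable-+ {G} {λ κ → β * dual κ₀ κ} rG (reachable-* {dual κ₀} β (reachable-dual κ₀))
                          , cong₂ _∷_ head (trans tail G≡v)
    where
    β = toℕ a + (p ∸ G κ₀ % p)
    G' : Pt → ℕ
    G' κ = G κ + β * dual κ₀ κ
    head : toF p (G' κ₀) ≡ a
    head = trans (toF-≡ₚ {G' κ₀} {toℕ a} (begin
      (G κ₀ + β * dual κ₀ κ₀) % p ≡⟨ ≡ₚ-+ʳ (β * dual κ₀ κ₀) (β * 1) (G κ₀) (≡ₚ-*ʳ (dual κ₀ κ₀) 1 β
                                       (trans (dual-≡ₚ κ₀ κ₀) (cong (_% p) (δ-diag κ₀ κ₀ (λ _ → refl))))) ⟩
      (G κ₀ + β * 1) % p          ≡⟨ cong (λ z → (G κ₀ + z) % p) (*-identityʳ β) ⟩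
      (G κ₀ + β) % p              ≡⟨ ≡ₚ-+ˡ (G κ₀) (G κ₀ % p) β (sym (≡ₚ-% (G κ₀))) ⟩
      (G κ₀ % p + β) % p          ≡⟨ cong (_% p) (cancel (G κ₀ % p) (toℕ a) p (<⇒≤ (m%n<n (G κ₀) p))) ⟩
      (toℕ a + p) % p             ≡⟨ [m+n]%n≡m%n (toℕ a) p ⟩
      toℕ a % p                   ∎)) (toF-toℕ a)
      where
      open ≡-Reasoning
      cancel : ∀ r x m → r ≤ m → r + (x + (m ∸ r)) ≡ x + m
      cancel r x m r≤m = trans (+-x∙yz≈y∙xz r x (m ∸ r)) (cong (x +_) (m+[n∸m]≡n r≤m))
    tail : map (λ κ → toF p (G' κ)) L ≡ map (λ κ → toF p (G κ)) L
    tail = map-cong-local (All.map (λ {κ} κ₀≠κ → toF-≡ₚ {G' κ} {G κ}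
      (trans (≡ₚ-+ʳ (β * dual κ₀ κ) 0 (G κ) (trans (≡ₚ-*ʳ (dual κ₀ κ) 0 β
                (trans (dual-≡ₚ κ₀ κ) (cong (_% p) (δ-off κ₀ κ κ₀≠κ)))) (cong (_% p) (*-zeroʳ β))))
             (cong (_% p) (+-identityʳ (G κ))))) κ₀∉L)

  -- The exponents in 𝒦 are pairwise distinct, so every vector of 𝔽^K is reachable.
  reach-each : ∀ v → length v ≡ K n p → Σ ℕ λ M → Reach M v
  reach-each v len with reachable-any (𝒦 n p) distinct v len
    where
    distinct : AllPairs Distinct (𝒦 n p)
    distinct = AllPairsP.filter⁺ nonzero? (allFuns-distinct n (allFin p) (allFin⁺ p))
  ... | _ , (M , r) , G≡v = M , subst (Reach M) G≡v r

  reach-list : ∀ (ws : List V) → All (λ w → length w ≡ K n p) ws → Σ ℕ λ M → All (Reach M) ws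
  reach-list []       []           = 0 , []
  reach-list (w ∷ ws) (lw ∷ lws) with reach-each w lw | reach-list ws lws
  ... | M₁ , r₁ | M₂ , rs₂ =
    M₁ + M₂ , subst (λ M → Reach M w) (+-comm M₂ M₁) (Reach-pad M₂ r₁) ∷ All.map (Reach-pad M₁) rs₂

  visits-all : Σ ℕ λ M → All (λ u → 1 ≤ visits (suc M) u) 𝔽ᴷ
  visits-all with reach-list 𝔽ᴷ (allLists-length p (K n p))
  ... | M , rs = M , All.map (λ r → Reach⇒visits (Reach-pad 1 r)) rs

-- Passage to ℚ.  Rationals in ℚ are normalised, so the estimates are carried out
-- in ℚᵘ (unnormalised fractions), into which toℚᵘ is a homomorphism.
module ToRationals where
  open import Data.Integer as ℤ using (ℤ; +_)
  import Data.Integer.Properties as ℤP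
  open import Data.Rational as ℚ using (ℚ; toℚᵘ)
  import Data.Rational.Properties as ℚP
  open import Data.Rational.Unnormalised as ℚᵘ
    using (ℚᵘ; *≡*; *≤*; *<*) renaming (_/_ to _/ᵘ_; _≃_ to _≃ᵘ_; _≤_ to _≤ᵘ_; _<_ to _<ᵘ_)
  import Data.Rational.Unnormalised.Properties as ℚᵘP

  toℚᵘ-/ : ∀ (i : ℤ) n .{{_ : NonZero n}} → toℚᵘ (i ℚ./ n) ≃ᵘ (i /ᵘ n)
  toℚᵘ-/ i (suc n) = ℚP.toℚᵘ-fromℚᵘ (i /ᵘ suc n)

  sumᵘ : List ℚᵘ → ℚᵘ
  sumᵘ = List.foldr ℚᵘ._+_ ℚᵘ.0ℚᵘ

  toℚᵘ-sumℚ : {B : Set} (W : List B) (f : B → ℚ) → toℚᵘ (sumℚ (map f W)) ≃ᵘ sumᵘ (map (toℚᵘ ∘ f) W)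
  toℚᵘ-sumℚ []      f = *≡* refl
  toℚᵘ-sumℚ (v ∷ W) f = ℚᵘP.≃-trans (ℚP.toℚᵘ-homo-+ (f v) _) (ℚᵘP.+-cong (ℚᵘP.≃-refl {toℚᵘ (f v)}) (toℚᵘ-sumℚ W f))

  sumᵘ-monoAll : {B : Set} {P : B → Set} (W : List B) (f g : B → ℚᵘ) →
                 All P W → (∀ v → P v → f v ≤ᵘ g v) → sumᵘ (map f W) ≤ᵘ sumᵘ (map g W)
  sumᵘ-monoAll []      f g []         e = ℚᵘP.≤-refl
  sumᵘ-monoAll (v ∷ W) f g (pv ∷ pW) e = ℚᵘP.+-mono-≤ (e v pv) (sumᵘ-monoAll W f g pW e)

  sumᵘ-/ : {B : Set} (W : List B) (e : B → ℕ) (D : ℕ) .{{_ : NonZero D}} →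
           sumᵘ (map (λ v → + e v /ᵘ D) W) ≃ᵘ (+ ∑ W e /ᵘ D)
  sumᵘ-/ []      e (suc _) = *≡* refl
  sumᵘ-/ (v ∷ W) e D@(suc _) = ℚᵘP.≃-trans (ℚᵘP.+-cong (ℚᵘP.≃-refl {+ e v /ᵘ D}) (sumᵘ-/ W e D)) (*≡* (begin
    (+ e v ℤ.* + D ℤ.+ + s ℤ.* + D) ℤ.* + D ≡⟨ cong₂ (λ x y → (x ℤ.+ y) ℤ.* + D) (sym (ℤP.pos-* (e v) D)) (sym (ℤP.pos-* s D)) ⟩
    (+ (e v * D) ℤ.+ + (s * D)) ℤ.* + D     ≡⟨ cong (ℤ._* + D) (sym (ℤP.pos-+ (e v * D) (s * D))) ⟩
    + (e v * D + s * D) ℤ.* + D             ≡⟨ sym (ℤP.pos-* (e v * D + s * D) D) ⟩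
    + ((e v * D + s * D) * D)               ≡⟨ cong +_ (trans (cong (_* D) (sym (*-distribʳ-+ D (e v) s))) (*-assoc (e v + s) D D)) ⟩
    + ((e v + s) * (D * D))                 ≡⟨ ℤP.pos-* (e v + s) (D * D) ⟩
    + (e v + s) ℤ.* + (D * D)               ∎))
    where
    open ≡-Reasoning
    s = ∑ W e

  /ᵘ-≤ : ∀ a b c d .{{_ : NonZero b}} .{{_ : NonZero d}} → a * d ≤ c * b → (+ a /ᵘ b) ≤ᵘ (+ c /ᵘ d)
  /ᵘ-≤ a (suc b) c (suc d) le = *≤* (subst₂ ℤ._≤_ (ℤP.pos-* a (suc d)) (ℤP.pos-* c (suc b)) (ℤ.+≤+ le))

  /ᵘ-< : ∀ a b c d .{{_ : NonZero b}} .{{_ : NonZero d}} → a * d < c * b → (+ a /ᵘ b) <ᵘ (+ c /ᵘ d)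
  /ᵘ-< a (suc b) c (suc d) lt = *<* (subst₂ ℤ._<_ (ℤP.pos-* a (suc d)) (ℤP.pos-* c (suc b)) (ℤ.+<+ lt))

  powℚ-/ : ∀ a b .{{_ : NonZero b}} N →
           toℚᵘ (powℚ ((+ a) ℚ./ b) N) ≃ᵘ _/ᵘ_ (+ (a ^ N)) (b ^ N) {{m^n≢0 b N}}
  powℚ-/ a b zero    = toℚᵘ-/ (+ 1) 1
  powℚ-/ a b@(suc _) (suc N) = ℚᵘP.≃-trans (ℚP.toℚᵘ-homo-* ((+ a) ℚ./ b) (powℚ ((+ a) ℚ./ b) N))
    (ℚᵘP.≃-trans (ℚᵘP.*-cong (toℚᵘ-/ (+ a) b) (powℚ-/ a b N)) (fraction-* (b ^ N) {{m^n≢0 b N}}))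
    where
    fraction-* : ∀ m .{{_ : NonZero m}} → ((+ a /ᵘ b) ℚᵘ.* (+ (a ^ N) /ᵘ m)) ≃ᵘ _/ᵘ_ (+ (a * a ^ N)) (b * m) {{m*n≢0 b m}}
    fraction-* (suc m) = *≡* (cong (ℤ._* + (b * suc m)) (sym (ℤP.pos-* a (a ^ N))))

  ∣⊖∣-slack : ∀ m T D → T ≤ m + D → ℤ.∣ m ℤ.⊖ T ∣ ≤ (m + 2 * D) ∸ T
  ∣⊖∣-slack m T D T≤m+D with ≤-total T m
  ... | inj₁ T≤m = subst (_≤ (m + 2 * D) ∸ T) (sym (cong ℤ.∣_∣ (ℤP.⊖-≥ T≤m))) (∸-monoˡ-≤ T (m≤m+n m _))
  ... | inj₂ m≤T = subst (_≤ (m + 2 * D) ∸ T) (sym (ℤP.∣⊖∣-≤ m≤T)) (begin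
    T ∸ m             ≤⟨ m≤n+o⇒m∸n≤o T m T≤m+D ⟩
    D                 ≡⟨ sym (m+n∸n≡m D T) ⟩
    (D + T) ∸ T       ≤⟨ ∸-monoˡ-≤ T (subst (_≤ m + D + D) (+-comm T D) (+-monoˡ-≤ D T≤m+D)) ⟩
    (m + D + D) ∸ T   ≡⟨ cong (_∸ T) (trans (+-assoc m D D) (cong (λ z → m + (D + z)) (sym (+-identityʳ D)))) ⟩
    (m + 2 * D) ∸ T   ∎)
    where open ≤-Reasoning

  term-bound : ∀ (c T Q D : ℕ) .{{_ : NonZero T}} .{{_ : NonZero Q}} → T ≤ Q * c + D →
               toℚᵘ (ℚ.∣ (+ c) ℚ./ T ℚ.- (+ 1) ℚ./ Q ∣) ≤ᵘ _/ᵘ_ (+ ((Q * c + 2 * D) ∸ T)) (T * Q) {{m*n≢0 T Q}}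
  term-bound c T@(suc _) Q@(suc _) D T≤ = ℚᵘP.≤-respˡ-≃ (ℚᵘP.≃-sym to-fractions) (*≤*
    (subst₂ ℤ._≤_ (ℤP.pos-* ℤ.∣ z ∣ (T * Q)) (ℤP.pos-* slack (T * Q)) (ℤ.+≤+ (*-monoˡ-≤ (T * Q) ∣z∣≤slack))))
    where
    to-fractions : toℚᵘ (ℚ.∣ (+ c) ℚ./ T ℚ.- (+ 1) ℚ./ Q ∣) ≃ᵘ ℚᵘ.∣ (+ c /ᵘ T) ℚᵘ.- (+ 1 /ᵘ Q) ∣
    to-fractions = ℚᵘP.≃-trans (ℚP.toℚᵘ-homo-∣-∣ _) (ℚᵘP.∣-∣-cong (ℚᵘP.≃-trans
      (ℚP.toℚᵘ-homo-+ ((+ c) ℚ./ T) (ℚ.- ((+ 1) ℚ./ Q)))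
      (ℚᵘP.+-cong (toℚᵘ-/ (+ c) T) (ℚᵘP.≃-trans (ℚP.toℚᵘ-homo‿- ((+ 1) ℚ./ Q)) (ℚᵘP.-‿cong (toℚᵘ-/ (+ 1) Q))))))
    z : ℤ
    z = (+ c) ℤ.* (+ Q) ℤ.+ (ℤ.- (+ 1)) ℤ.* (+ T)
    slack = (Q * c + 2 * D) ∸ T
    z≡ : z ≡ (Q * c) ℤ.⊖ T
    z≡ = trans (cong₂ ℤ._+_ (trans (sym (ℤP.pos-* c Q)) (cong +_ (*-comm c Q))) (ℤP.-1*i≡-i (+ T))) (ℤP.m-n≡m⊖n (Q * c) T)
    ∣z∣≤slack : ℤ.∣ z ∣ ≤ slack
    ∣z∣≤slack = subst (_≤ slack) (sym (cong ℤ.∣_∣ z≡)) (∣⊖∣-slack (Q * c) T D T≤)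

  ∑-slack : {B : Set} (W : List B) (c : B → ℕ) (T Q D : ℕ) →
            length W ≡ Q → ∑ W c ≡ T → All (λ v → T ≤ Q * c v + D) W →
            ∑ W (λ v → (Q * c v + 2 * D) ∸ T) ≡ Q * (2 * D)
  ∑-slack W c T Q D |W| ∑c bounds = +-cancelʳ-≡ (Q * T) _ _ (begin
    ∑ W slack + Q * T                      ≡⟨ cong (λ z → ∑ W slack + z * T) (sym |W|) ⟩
    ∑ W slack + length W * T               ≡⟨ cong (λ z → ∑ W slack + z) (sym (∑-const W T)) ⟩
    ∑ W slack + ∑ W (λ _ → T)              ≡⟨ sym (∑-+ W slack (λ _ → T)) ⟩
    ∑ W (λ v → slack v + T)                ≡⟨ ∑-congAll W bounds (λ v T≤ → m∸n+n≡m (≤-trans T≤ (+-monoʳ-≤ (Q * c v) (m≤n*m D 2)))) ⟩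
    ∑ W (λ v → Q * c v + 2 * D)            ≡⟨ ∑-+ W (λ v → Q * c v) (λ _ → 2 * D) ⟩
    ∑ W (λ v → Q * c v) + ∑ W (λ _ → 2 * D) ≡⟨ cong₂ _+_ (trans (∑-*ˡ W Q c) (cong (Q *_) ∑c)) (trans (∑-const W _) (cong (_* (2 * D)) |W|)) ⟩
    Q * T + Q * (2 * D)                    ≡⟨ +-comm (Q * T) _ ⟩
    Q * (2 * D) + Q * T                    ∎)
    where
    open ≡-Reasoning
    slack : _ → ℕ
    slack v = (Q * c v + 2 * D) ∸ T

  distance-bound : {B : Set} (W : List B) (c : B → ℕ) (T Q D : ℕ) .{{_ : NonZero T}} .{{_ : NonZero Q}} →
                   length W ≡ Q → ∑ W c ≡ T → All (λ v → T ≤ Q * c v + D) W →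
                   toℚᵘ (sumℚ (map (λ v → ℚ.∣ (+ c v) ℚ./ T ℚ.- (+ 1) ℚ./ Q ∣) W)) ≤ᵘ ((+ (2 * D)) /ᵘ T)
  distance-bound W c T Q D |W| ∑c bounds = begin
    toℚᵘ (sumℚ (map (λ v → ℚ.∣ (+ c v) ℚ./ T ℚ.- (+ 1) ℚ./ Q ∣) W))  ≃⟨ toℚᵘ-sumℚ W _ ⟩
    sumᵘ (map (λ v → toℚᵘ (ℚ.∣ (+ c v) ℚ./ T ℚ.- (+ 1) ℚ./ Q ∣)) W)  ≤⟨ sumᵘ-monoAll W _ _ bounds (λ v T≤ → term-bound (c v) T Q D T≤) ⟩
    sumᵘ (map (λ v → _/ᵘ_ (+ slack v) (T * Q) {{TQ≢0}}) W)            ≃⟨ sumᵘ-/ W slack (T * Q) {{TQ≢0}} ⟩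
    _/ᵘ_ (+ ∑ W slack) (T * Q) {{TQ≢0}}                               ≤⟨ /ᵘ-≤ _ (T * Q) (2 * D) T {{TQ≢0}} (≤-reflexive cross) ⟩
    (+ (2 * D)) /ᵘ T                                                  ∎
    where
    open ℚᵘP.≤-Reasoning
    TQ≢0 = m*n≢0 T Q
    slack : _ → ℕ
    slack v = (Q * c v + 2 * D) ∸ T
    cross : ∑ W slack * T ≡ 2 * D * (T * Q)
    cross = trans (cong (_* T) (∑-slack W c T Q D |W| ∑c bounds)) (reorder Q (2 * D) T)
      where
      reorder : ∀ q d t → q * d * t ≡ d * (t * q)
      reorder = solve-∀

module RateArithmetic where

  -- (1 - x)^M ≥ 1 - M x in the form  b^M (b - M d) ≤ a^M b  for b = a + d.
  bernoulli-upper : ∀ a d M → (a + d) ^ M * (a + d) ≤ a ^ M * (a + d) + M * d * (a + d) ^ M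
  bernoulli-upper a d zero    = ≤-reflexive (base a d)
    where
    base : ∀ a d → 1 * (a + d) ≡ 1 * (a + d) + 0 * d * 1
    base = solve-∀
  bernoulli-upper a d (suc M) = begin
    b * b ^ M * b                                          ≡⟨ *-assoc b (b ^ M) b ⟩
    b * (b ^ M * b)                                        ≤⟨ *-monoʳ-≤ b (bernoulli-upper a d M) ⟩
    b * (a ^ M * b + M * d * b ^ M)                        ≡⟨ expand a d (a ^ M) (b ^ M) M ⟩
    a * a ^ M * b + a ^ M * b * d + M * d * (b * b ^ M)     ≤⟨ +-monoˡ-≤ (M * d * (b * b ^ M)) (+-monoʳ-≤ (a * a ^ M * b)
                                                                (*-monoˡ-≤ d (*-monoˡ-≤ b (^-monoˡ-≤ M (m≤m+n a d))))) ⟩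
    a * a ^ M * b + b ^ M * b * d + M * d * (b * b ^ M)     ≡⟨ collect a d (a ^ M) (b ^ M) M ⟩
    a * a ^ M * b + suc M * d * (b * b ^ M)                ∎
    where
    open ≤-Reasoning
    b = a + d
    expand : ∀ a d x y M → (a + d) * (x * (a + d) + M * d * y) ≡ a * x * (a + d) + x * (a + d) * d + M * d * ((a + d) * y)
    expand = solve-∀
    collect : ∀ a d x y M → a * x * (a + d) + y * (a + d) * d + M * d * ((a + d) * y) ≡ a * x * (a + d) + suc M * d * ((a + d) * y)
    collect = solve-∀

  bernoulli-lower : ∀ x y k → x ^ suc k + suc k * y * x ^ k ≤ (x + y) ^ suc k
  bernoulli-lower x y zero    = ≤-reflexive (base x y)
    where
    base : ∀ x y → x * 1 + 1 * y * 1 ≡ (x + y) * 1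
    base = solve-∀
  bernoulli-lower x y (suc k) = begin
    x * x ^ suc k + suc (suc k) * y * x ^ suc k                               ≤⟨ m≤m+n _ (suc k * y * y * x ^ k) ⟩
    x * x ^ suc k + suc (suc k) * y * x ^ suc k + suc k * y * y * x ^ k        ≡⟨ factor x y (x ^ k) k ⟩
    (x + y) * (x ^ suc k + suc k * y * x ^ k)                                  ≤⟨ *-monoʳ-≤ (x + y) (bernoulli-lower x y k) ⟩
    (x + y) * (x + y) ^ suc k                                                  ∎
    where
    open ≤-Reasoning
    factor : ∀ x y z k → x * (x * z) + suc (suc k) * y * (x * z) + suc k * y * y * z ≡ (x + y) * (x * z + suc k * y * z)
    factor = solve-∀

  ^-exchange : ∀ a b N N' → a ≤ b → N ≤ N' → a ^ N' * b ^ N ≤ a ^ N * b ^ N'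
  ^-exchange a b N N' a≤b N≤N' = begin
    a ^ N' * b ^ N            ≡⟨ cong (λ z → a ^ z * b ^ N) (sym N+s) ⟩
    a ^ (N + s) * b ^ N       ≡⟨ cong (_* b ^ N) (^-distribˡ-+-* a N s) ⟩
    a ^ N * a ^ s * b ^ N     ≤⟨ *-monoˡ-≤ (b ^ N) (*-monoʳ-≤ (a ^ N) (^-monoˡ-≤ s a≤b)) ⟩
    a ^ N * b ^ s * b ^ N     ≡⟨ reorder (a ^ N) (b ^ s) (b ^ N) ⟩
    a ^ N * (b ^ N * b ^ s)   ≡⟨ cong (a ^ N *_) (sym (^-distribˡ-+-* b N s)) ⟩
    a ^ N * b ^ (N + s)       ≡⟨ cong (λ z → a ^ N * b ^ z) N+s ⟩
    a ^ N * b ^ N'            ∎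
    where
    open ≤-Reasoning
    s = N' ∸ N
    N+s : N + s ≡ N'
    N+s = m+[n∸m]≡n N≤N'
    reorder : ∀ x y z → x * y * z ≡ x * (z * y)
    reorder = solve-∀

  -- Constants: L = Q + E walks per block of M = M' + 1 columns, and q = a/b with
  -- a = M (L + E) + M' Q and b = a + Q.
  module Rate (Q E M' : ℕ) (Q≥1 : 1 ≤ Q) where
    M L a b : ℕ
    M = suc M'
    L = Q + E
    a = M * (L + E) + M' * Q
    b = a + Q

    -- Over one block, (b/a)^M ≤ 2L/(L + E).
    block-rate : (L + E) * b ^ M ≤ 2 * L * a ^ M
    block-rate = *-cancelˡ-≤ M (+-cancelʳ-≤ (M * Q * b ^ M) (M * ((L + E) * b ^ M)) (M * (2 * L * a ^ M)) (begin
      M * ((L + E) * b ^ M) + M * Q * b ^ M ≡⟨ lhs M' Q E (b ^ M) ⟩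
      b ^ M * b                           ≤⟨ bernoulli-upper a Q M ⟩
      a ^ M * b + M * Q * b ^ M           ≡⟨ cong (_+ M * Q * b ^ M) (rhs M' Q E (a ^ M)) ⟩
      M * (2 * L * a ^ M) + M * Q * b ^ M ∎))
      where
      open ≤-Reasoning
      lhs : ∀ M' Q E y → suc M' * ((Q + E + E) * y) + suc M' * Q * y ≡ y * (suc M' * (Q + E + E) + M' * Q + Q)
      lhs = solve-∀
      rhs : ∀ M' Q E x → x * (suc M' * (Q + E + E) + M' * Q + Q) ≡ suc M' * (2 * (Q + E) * x)
      rhs = solve-∀

    -- After j ≥ 3 + 2E blocks, 4L (2E)^j ≤ (L + E)^{j+1}, i.e. 2 (E/L)^j ≤ ((L + E)/(2L))^{j+1}.
    defect-rate : ∀ j → 3 + 2 * E ≤ j → 4 * L * (2 * E) ^ j ≤ (L + E) ^ suc j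
    defect-rate j j≥ = begin
      4 * L * (2 * E) ^ j                         ≤⟨ *-monoˡ-≤ ((2 * E) ^ j) coefficient ⟩
      (2 * E + suc j * Q) * (2 * E) ^ j           ≡⟨ distrib (2 * E) ((2 * E) ^ j) (suc j * Q) ⟩
      (2 * E) ^ suc j + suc j * Q * (2 * E) ^ j   ≤⟨ bernoulli-lower (2 * E) Q j ⟩
      (2 * E + Q) ^ suc j                         ≡⟨ cong (_^ suc j) (rearrange Q E) ⟩
      (L + E) ^ suc j                             ∎
      where
      open ≤-Reasoning
      distrib : ∀ x z w → (x + w) * z ≡ x * z + w * z
      distrib = solve-∀
      rearrange : ∀ Q E → 2 * E + Q ≡ Q + E + E
      rearrange = solve-∀
      coefficient : 4 * L ≤ 2 * E + suc j * Q
      coefficient = begin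
        4 * L                              ≡⟨ split₁ Q E ⟩
        2 * E + (4 * Q + 2 * E * 1)        ≤⟨ +-monoʳ-≤ (2 * E) (+-monoʳ-≤ (4 * Q) (*-monoʳ-≤ (2 * E) Q≥1)) ⟩
        2 * E + (4 * Q + 2 * E * Q)        ≡⟨ cong (2 * E +_) (split₂ Q E) ⟩
        2 * E + ((3 + 2 * E) * Q + Q)      ≤⟨ +-monoʳ-≤ (2 * E) (+-monoˡ-≤ Q (*-monoˡ-≤ Q j≥)) ⟩
        2 * E + (j * Q + Q)                ≡⟨ cong (2 * E +_) (+-comm (j * Q) Q) ⟩
        2 * E + suc j * Q                  ∎
        where
        split₁ : ∀ Q E → 4 * (Q + E) ≡ 2 * E + (4 * Q + 2 * E * 1)
        split₁ = solve-∀
        split₂ : ∀ Q E → 4 * Q + 2 * E * Q ≡ (3 + 2 * E) * Q + Q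
        split₂ = solve-∀

    a≤b : a ≤ b
    a≤b = m≤m+n a Q

    b≥1 : 1 ≤ b
    b≥1 = ≤-trans Q≥1 (m≤n+m Q a)

    a≥1 : 1 ≤ a
    a≥1 = ≤-trans Q≥1 (≤-trans (m≤m+n Q E) (≤-trans (m≤m+n L E)
            (≤-trans (m≤n*m (L + E) M) (m≤m+n (M * (L + E)) (M' * Q)))))

    rate : ∀ j r → 3 + 2 * E ≤ j → r < M → 2 * E ^ j * b ^ (j * M + r) ≤ a ^ (j * M + r) * L ^ j
    rate j r j≥ r<M = *-cancelʳ-≤ (2 * E ^ j * b ^ N) (a ^ N * L ^ j) C {{C≢0}} (begin
      2 * E ^ j * b ^ N * (b ^ N' * (2 * L) ^ suc j)
        ≡⟨ cong (λ z → 2 * E ^ j * b ^ N * (b ^ N' * (2 * L * z))) (^-distribʳ-* 2 L j) ⟩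
      2 * E ^ j * b ^ N * (b ^ N' * (2 * L * (2 ^ j * L ^ j)))
        ≡⟨ reorder₁ (E ^ j) (b ^ N) (b ^ N') L (2 ^ j) (L ^ j) ⟩
      4 * L * (2 ^ j * E ^ j) * L ^ j * b ^ N * b ^ N'
        ≡⟨ cong (λ z → 4 * L * z * L ^ j * b ^ N * b ^ N') (sym (^-distribʳ-* 2 E j)) ⟩
      4 * L * (2 * E) ^ j * L ^ j * b ^ N * b ^ N'
        ≤⟨ *-monoˡ-≤ (b ^ N') (*-monoˡ-≤ (b ^ N) (*-monoˡ-≤ (L ^ j) (defect-rate j j≥))) ⟩
      (L + E) ^ suc j * L ^ j * b ^ N * b ^ N'
        ≡⟨ reorder₂ ((L + E) ^ suc j) (L ^ j) (b ^ N) (b ^ N') ⟩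
      (L + E) ^ suc j * b ^ N' * (L ^ j * b ^ N)
        ≡⟨ cong (λ z → (L + E) ^ suc j * z * (L ^ j * b ^ N)) (sym (^-*-assoc b M (suc j))) ⟩
      (L + E) ^ suc j * (b ^ M) ^ suc j * (L ^ j * b ^ N)
        ≡⟨ cong (_* (L ^ j * b ^ N)) (sym (^-distribʳ-* (L + E) (b ^ M) (suc j))) ⟩
      ((L + E) * b ^ M) ^ suc j * (L ^ j * b ^ N)
        ≤⟨ *-monoˡ-≤ (L ^ j * b ^ N) (^-monoˡ-≤ (suc j) block-rate) ⟩
      (2 * L * a ^ M) ^ suc j * (L ^ j * b ^ N)
        ≡⟨ cong (_* (L ^ j * b ^ N)) (trans (^-distribʳ-* (2 * L) (a ^ M) (suc j)) (cong ((2 * L) ^ suc j *_) (^-*-assoc a M (suc j)))) ⟩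
      (2 * L) ^ suc j * a ^ N' * (L ^ j * b ^ N)
        ≡⟨ reorder₃ ((2 * L) ^ suc j) (a ^ N') (L ^ j) (b ^ N) ⟩
      (2 * L) ^ suc j * L ^ j * (a ^ N' * b ^ N)
        ≤⟨ *-monoʳ-≤ ((2 * L) ^ suc j * L ^ j) (^-exchange a b N N' a≤b N≤N') ⟩
      (2 * L) ^ suc j * L ^ j * (a ^ N * b ^ N')
        ≡⟨ reorder₄ ((2 * L) ^ suc j) (L ^ j) (a ^ N) (b ^ N') ⟩
      a ^ N * L ^ j * (b ^ N' * (2 * L) ^ suc j) ∎)
      where
      open ≤-Reasoning
      N N' C : ℕ
      N  = j * M + r
      N' = M * suc j
      C  = b ^ N' * (2 * L) ^ suc j
      C≢0 : NonZero C
      C≢0 = ℕ.>-nonZero (*-mono-≤ (subst (_≤ b ^ N') (^-zeroˡ N') (^-monoˡ-≤ N' b≥1))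
                                  (subst (_≤ (2 * L) ^ suc j) (^-zeroˡ (suc j)) (^-monoˡ-≤ (suc j) (≤-trans (≤-trans Q≥1 (m≤m+n Q E)) (m≤n*m L 2)))))
      N≤N' : N ≤ N'
      N≤N' = begin
        j * M + r  ≤⟨ +-monoʳ-≤ (j * M) (<⇒≤ r<M) ⟩
        j * M + M  ≡⟨ trans (+-comm (j * M) M) (trans (cong (M +_) (*-comm j M)) (sym (*-suc M j))) ⟩
        M * suc j  ∎
      reorder₁ : ∀ e bN bN' L u l → 2 * e * bN * (bN' * (2 * L * (u * l))) ≡ 4 * L * (u * e) * l * bN * bN'
      reorder₁ = solve-∀
      reorder₂ : ∀ x l bN bN' → x * l * bN * bN' ≡ x * bN' * (l * bN)
      reorder₂ = solve-∀
      reorder₃ : ∀ t aN' l bN → t * aN' * (l * bN) ≡ t * l * (aN' * bN)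
      reorder₃ = solve-∀
      reorder₄ : ∀ t l aN bN' → t * l * (aN * bN') ≡ aN * l * (bN' * t)
      reorder₄ = solve-∀

module Main (n : ℕ) {q : ℕ} (prime : Prime (suc (suc q))) where
  open import Data.Integer using (+_)
  open import Data.Rational as ℚ using (ℚ; toℚᵘ; 0ℚ; 1ℚ)
  import Data.Rational.Properties as ℚP
  open import Data.Rational.Unnormalised using () renaming (_/_ to _/ᵘ_; _≤_ to _≤ᵘ_)
  import Data.Rational.Unnormalised.Properties as ℚᵘP
  open PowerSums prime using (p)
  open Residues {p}
  open Walk n {p}
  open Doeblin n {p}
  open ToRationals

  Q≡ : Q ≡ p ^ K n p
  Q≡ = length-allLists p (K n p)

  Q≥1 : 1 ≤ Q
  Q≥1 = subst (1 ≤_) (sym Q≡) (m^n>0 p (K n p))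

  M' : ℕ
  M' = proj₁ (Spanning.visits-all n prime)

  open Contraction (suc M') (proj₂ (Spanning.visits-all n prime))
  open RateArithmetic.Rate Q excess M' Q≥1

  distance≤ : ∀ N D → DefectBound N D → toℚᵘ (dist n p N) ≤ᵘ _/ᵘ_ (+ (2 * D)) (p ^ (n * N)) {{m^n≢0 p (n * N)}}
  distance≤ N D defect = distance-bound 𝔽ᴷ (count N) (p ^ (n * N)) (p ^ K n p) D {{m^n≢0 p (n * N)}} {{m^n≢0 p (K n p)}}
    Q≡ (trans (∑-count N) (#samples≡ N))
    (All.map (λ {v} lv → subst₂ (λ T c → T ≤ c * count N v + D) (#samples≡ N) Q≡
                            (subst (λ c → #samples N ≤ Q * c + D) (sym (count≡hits N v)) (defect o v length-o lv)))
             (allLists-length p (K n p)))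

  instance
    b≢0 : NonZero b
    b≢0 = ℕ.>-nonZero b≥1

  ratio : ℚ
  ratio = (+ a) ℚ./ b

  ratio-pos : 0ℚ ℚ.< ratio
  ratio-pos = ℚP.toℚᵘ-cancel-< (ℚᵘP.<-respˡ-≃ (ℚᵘP.≃-sym (toℚᵘ-/ (+ 0) 1)) (ℚᵘP.<-respʳ-≃ (ℚᵘP.≃-sym (toℚᵘ-/ (+ a) b))
                (/ᵘ-< 0 1 a b (subst (0 <_) (sym (*-identityʳ a)) a≥1))))

  ratio<1 : ratio ℚ.< 1ℚ
  ratio<1 = ℚP.toℚᵘ-cancel-< (ℚᵘP.<-respʳ-≃ (ℚᵘP.≃-sym (toℚᵘ-/ (+ 1) 1)) (ℚᵘP.<-respˡ-≃ (ℚᵘP.≃-sym (toℚᵘ-/ (+ a) b))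
              (/ᵘ-< a b 1 1 (subst₂ _<_ (sym (*-identityʳ a)) (sym (*-identityˡ b)) (m<m+n a Q≥1)))))

  N₀ : ℕ
  N₀ = (3 + 2 * excess) * M

  bound : ∀ N → N₀ ≤ N → dist n p N ℚ.≤ powℚ ratio N
  bound N N₀≤N = ℚP.toℚᵘ-cancel-≤ (ℚᵘP.≤-trans (distance≤ N D defect)
    (ℚᵘP.≤-respʳ-≃ (ℚᵘP.≃-sym (powℚ-/ a b N)) (/ᵘ-≤ (2 * D) (p ^ (n * N)) (a ^ N) (b ^ N) {{m^n≢0 p (n * N)}} {{m^n≢0 b N}} cross)))
    where
    j = N / M
    r = N % M
    N≡ : N ≡ j * M + r
    N≡ = trans (m≡m%n+[m/n]*n N M) (+-comm r (j * M))
    j≥ : 3 + 2 * excess ≤ j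
    j≥ = subst (_≤ j) (m*n/n≡m (3 + 2 * excess) M) (/-monoˡ-≤ M N₀≤N)
    D = excess ^ j * #samples r
    defect : DefectBound N D
    defect = subst (λ N → DefectBound N D) (sym N≡) (contract-blocks j r)
    cross : 2 * D * b ^ N ≤ a ^ N * p ^ (n * N)
    cross = begin
      2 * (excess ^ j * #samples r) * b ^ N      ≡⟨ reorder (excess ^ j) (#samples r) (b ^ N) ⟩
      2 * excess ^ j * b ^ N * #samples r        ≡⟨ cong (λ z → 2 * excess ^ j * b ^ z * #samples r) N≡ ⟩
      2 * excess ^ j * b ^ (j * M + r) * #samples r ≤⟨ *-monoˡ-≤ (#samples r) (rate j r j≥ (m%n<n N M)) ⟩
      a ^ (j * M + r) * L ^ j * #samples r       ≡⟨ cong (λ z → a ^ z * L ^ j * #samples r) (sym N≡) ⟩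
      a ^ N * L ^ j * #samples r                 ≡⟨ *-assoc (a ^ N) (L ^ j) (#samples r) ⟩
      a ^ N * (L ^ j * #samples r)               ≡⟨ cong (a ^ N *_) (trans (sym (#samples-blocks j r)) (trans (cong #samples (sym N≡)) (#samples≡ N))) ⟩
      a ^ N * p ^ (n * N)                        ∎
      where
      open ≤-Reasoning
      reorder : ∀ x y z → 2 * (x * y) * z ≡ 2 * x * z * y
      reorder = solve-∀

open import Data.Rational using (ℚ; 0ℚ; 1ℚ) renaming (_<_ to _<ℚ_; _≤_ to _≤ℚ_)

-- Proposition 2.9.  Primes are at least 2.
proposition2p9 : (n p : ℕ) → 1 ≤ n → (pr : Prime p) →
    Σ ℚ λ q → (0ℚ <ℚ q) × (q <ℚ 1ℚ) × Σ ℕ λ N₀ → (N : ℕ) → N₀ ≤ N →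
      dist n p N {{prime⇒nonZero pr}} ≤ℚ powℚ q N
proposition2p9 n zero          _ pr = ⊥-elim (¬prime[0] pr)
proposition2p9 n (suc zero)    _ pr = ⊥-elim (¬prime[1] pr)
proposition2p9 n (suc (suc q)) _ pr = ratio , ratio-pos , ratio<1 , N₀ , bound
  where open Main n pr
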